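{- Let $r\ge1$ and let $G$ be a connected undirected graph with vertex set $\{1,\dots,r\}$ and $r-1$ edges $\{\alpha_i,\beta_i\}$, $i=1,\dots,r-1$. Then $$\operatorname{O}^{(r)}_{\mathfrak{f}}(X_1,\dots,X_r)\equiv\prod_{i=1}^{r-1}\operatorname{O}^{(2)}_{\mathfrak{f}}(X_{\alpha_i},X_{\beta_i})\pmod{(\mathfrak{f}(X_1),\dots,\mathfrak{f}(X_r))}.$$
   Context: Let $\mathbb{F}_q$ be a finite field and $\mathfrak{f}(t)=a_nt^n+\cdots+a_0\in\mathbb{F}_q[t]$ monic of degree $n\ge1$. For a variable $X$, $\operatorname{D}_{\mathfrak{f}}$ is the $\mathbb{F}_q$-linear map on polynomials in $X$ of degree $<n$ with $\operatorname{D}_{\mathfrak{f}}(X^i)=\sum_{j=0}^{n-i-1}a_{i+j+1}X^j$ for $0\le i\le n-1$. Weil operators: $\operatorname{O}^{(1)}_{\mathfrak{f}}(X_1)=1$; $\operatorname{O}^{(2)}_{\mathfrak{f}}(X_1,X_2)=\sum_{k=0}^{n-1}\operatorname{D}_{\mathfrak{f}}(X_1^k)X_2^k$; for $r>2$, $\operatorname{O}^{(r)}_{\mathfrak{f}}(X_1,\dots,X_r)$ is the unique polynomial whose degree in each $X_i$ is $<n$ and which is congruent to $\prod_{j=1}^{r-1}\operatorname{O}^{(2)}_{\mathfrak{f}}(X_j,X_r)$ modulo $\mathfrak{f}(X_r)$. -}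

module Defs where

open import Level using (_⊔_; Lift)
open import Data.Empty.Polymorphic using (⊥)
open import Algebra.Bundles using (CommutativeRing)
open import Data.Nat as ℕ using (ℕ; zero; suc; _∸_; _≤_)
open import Data.Fin as Fin using (Fin; zero; suc; fromℕ<; fromℕ; inject₁)
open import Data.Product using (Σ; ∃; _×_; _,_)
open import Data.Sum using (_⊎_)
open import Relation.Nullary using (¬_; yes; no)
open import Relation.Binary.PropositionalEquality using (_≡_)
open import Relation.Binary.Construct.Closure.ReflexiveTransitive using (Star)

IsFiniteField : ∀ {c ℓ} → CommutativeRing c ℓ → Set (c ⊔ ℓ)
IsFiniteField R =
  (¬ (0# ≈ 1#)) ×
  ((x : Carrier) → ¬ (x ≈ 0#) → ∃ λ y → x * y ≈ 1#) ×
  (∃ λ q → Σ (Fin q → Carrier) λ enum → (x : Carrier) → ∃ λ i → enum i ≈ x)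
  where open CommutativeRing R

Adj : ∀ {r e} → (α β : Fin e → Fin r) → Fin r → Fin r → Set
Adj α β u v = ∃ λ i → (α i ≡ u × β i ≡ v) ⊎ (α i ≡ v × β i ≡ u)

Connected : ∀ {r e} → (α β : Fin e → Fin r) → Set
Connected α β = ∀ u v → Star (Adj α β) u v

-- Polynomials in r variables X_0 … X_{r-1} over R, represented by their
-- coefficient functions on exponent vectors.

module Poly {c ℓ} (R : CommutativeRing c ℓ) where
  open CommutativeRing R using (_≈_; _+_; _*_; _-_; 0#; 1#) renaming (Carrier to K)

  Mon : ℕ → Set
  Mon r = Fin r → ℕ

  -- coefficient functions (a priori formal power series)
  Series : ℕ → Set c
  Series r = Mon r → K

  IsPoly : ∀ {r} → Series r → Set ℓ
  IsPoly P = ∃ λ d → ∀ m i → d ℕ.< m i → P m ≈ 0#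

  _≈ₚ_ : ∀ {r} → Series r → Series r → Set ℓ
  P ≈ₚ Q = ∀ m → P m ≈ Q m

  cons : ∀ {r} → ℕ → Mon r → Mon (suc r)
  cons k a zero = k
  cons k a (suc i) = a i

  tl : ∀ {r} → Mon (suc r) → Mon r
  tl m i = m (suc i)

  sumLT : ℕ → (ℕ → K) → K
  sumLT zero h = 0#
  sumLT (suc N) h = sumLT N h + h N

  sumFin : ∀ {k} → (Fin k → K) → K
  sumFin {zero} g = 0#
  sumFin {suc k} g = g zero + sumFin (λ i → g (suc i))

  sumBelow : ∀ {r} → Mon r → (Mon r → K) → K
  sumBelow {zero} m g = g (λ ())
  sumBelow {suc r} m g =
    sumLT (suc (m zero)) (λ k → sumBelow (tl m) (λ a → g (cons k a)))

  _*ₚ_ : ∀ {r} → Series r → Series r → Series r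
  (P *ₚ Q) m = sumBelow m (λ a → P a * Q (λ i → m i ∸ a i))

  constP : ∀ {r} → K → Series r
  constP {zero} k m = k
  constP {suc r} k m with m zero
  ... | zero = constP k (tl m)
  ... | suc _ = 0#

  1ₚ : ∀ {r} → Series r
  1ₚ = constP 1#

  -- p(X_j) for a univariate coefficient function p
  single : ∀ {r} → Fin r → (ℕ → K) → Series r
  single {suc r} zero p m = constP (p (m zero)) (tl m)
  single {suc r} (suc j) p m with m zero
  ... | zero = single j p (tl m)
  ... | suc _ = 0#

  prodFin : ∀ {r k} → (Fin k → Series r) → Series r
  prodFin {k = zero} F = 1ₚ
  prodFin {k = suc k} F = F zero *ₚ prodFin (λ i → F (suc i))

  sumLTₚ : ∀ {r} → ℕ → (ℕ → Series r) → Series r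
  sumLTₚ N F m = sumLT N (λ k → F k m)

  CongMod : ∀ {r g} → (Fin g → Series r) → Series r → Series r → Set (c ⊔ ℓ)
  CongMod {r} {g} gens P Q =
    Σ (Fin g → Series r) λ H →
      ((i : Fin g) → IsPoly (H i)) ×
      (∀ m → P m - Q m ≈ sumFin (λ i → (gens i *ₚ H i) m))

  tpow : ℕ → ℕ → K
  tpow k e with e ℕ.≟ k
  ... | yes _ = 1#
  ... | no _ = 0#

  -- data depending on f(t) = t^n + a_{n-1} t^{n-1} + … + a_0

  module WithF (n : ℕ) (a : Fin n → K) where

    fcoef : ℕ → K
    fcoef k with k ℕ.<? n
    ... | yes k<n = a (fromℕ< k<n)
    ... | no _ with k ℕ.≟ n
    ...   | yes _ = 1#
    ...   | no _ = 0#

    fX : ∀ {r} → Fin r → Series r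
    fX j = single j fcoef

    -- D_f(t^k) = Σ_{j=0}^{n-k-1} a_{k+j+1} t^j
    Dmono : ℕ → ℕ → K
    Dmono k j with j ℕ.<? n ∸ k
    ... | yes _ = fcoef (k ℕ.+ j ℕ.+ 1)
    ... | no _ = 0#

    -- O^(2)_f(X_p, X_q) = Σ_{k=0}^{n-1} D_f(X_p^k) X_q^k
    O2 : ∀ {r} → Fin r → Fin r → Series r
    O2 p q = sumLTₚ n (λ k → single p (Dmono k) *ₚ single q (tpow k))

    Reduced : ∀ {r} → Series r → Set ℓ
    Reduced P = ∀ m i → n ≤ m i → P m ≈ 0#

    -- P is (the) Weil operator O^(r)_f(X_1, …, X_r)  (variables indexed from 0)
    IsWeilOp : (r : ℕ) → Series r → Set (c ⊔ ℓ)
    IsWeilOp zero P = ⊥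
    IsWeilOp (suc zero) P = Lift (c ⊔ ℓ) (P ≈ₚ 1ₚ)
    IsWeilOp (suc (suc zero)) P = Lift (c ⊔ ℓ) (P ≈ₚ O2 zero (suc zero))
    IsWeilOp (suc (suc (suc s))) P =
      Reduced P ×
      CongMod (λ (_ : Fin 1) → fX (fromℕ (suc (suc s)))) P
              (prodFin (λ j → O2 (inject₁ j) (fromℕ (suc (suc s)))))

-- Work in A = K[X₀, …, X_s] / (f(X₀), …, f(X_s)) and write E(x, y) for the class of O⁽²⁾_f(X_x, X_y).
-- Since D_f(t^k) is the Horner polynomial f_{k+1}(t) and f_k = a_k + t f_{k+1}, the product
-- O⁽²⁾_f(X, Y) (X − Y) telescopes to f(X) − f(Y).  Hence E(y, z) X_y = E(y, z) X_z in A, so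
-- E(y, z) g(X_y) = E(y, z) g(X_z) for every polynomial g, and as E(x, y) is a polynomial in X_y,
-- E(y, z) E(x, y) = E(y, z) E(x, z): next to the edge y–z, the edge x–y may slide to x–z.
-- Inserting the edges of the tree one at a time (union–find), slides keep the product over the
-- inserted edges equal to a product over a forest of stars, each centred at the root of its
-- component.  Counting non-roots shows that no edge of a connected graph with r − 1 edges on
-- r vertices closes a cycle, so the tree ends as a single star, which slides to the star centred
-- at X_r; and O⁽ʳ⁾_f is congruent to that star modulo f(X_r) by definition.

module Submission where

open import Level using (_⊔_; lift)
open import Algebra.Bundles using (CommutativeMonoid; CommutativeRing)
open import Algebra.Structures using (IsCommutativeRing)
open import Data.Bool using (true; false; if_then_else_)
open import Data.Fin as Fin using (Fin; zero; suc; _≟_; fromℕ; inject₁; toℕ)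
open import Data.Fin.Properties using (punchInᵢ≢i; fromℕ≢inject₁; toℕ-inject₁; toℕ-fromℕ)
open import Data.Nat as ℕ using (ℕ; zero; suc; _∸_; _≤_; _<_; s≤s)
import Data.Nat.Properties as ℕ
open import Data.Product using (Σ; ∃; _×_; _,_; proj₁; proj₂)
open import Data.Sum using (inj₁; inj₂)
open import Data.Vec.Functional using (Vector; updateAt; removeAt)
open import Data.Vec.Functional.Properties using (updateAt-updates; updateAt-minimal)
open import Function using (id; _∘_; const)
open import Relation.Binary.Construct.Closure.ReflexiveTransitive using (fold)
open import Relation.Binary.PropositionalEquality as ≡ using (_≡_; _≢_; _≗_; module ≡-Reasoning)
open import Relation.Nullary using (Dec; yes; no; does; contradiction)
open import Relation.Nullary.Decidable using (dec-true; dec-false)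
import Algebra.Properties.CommutativeMonoid.Sum ℕ.+-0-commutativeMonoid as ℕΣ

open import Defs

module CommutativeMonoidSum {c ℓ} (M : CommutativeMonoid c ℓ) where
  open CommutativeMonoid M
  open import Algebra.Properties.CommutativeMonoid.Sum M using (sum; sum-remove; sum-cong-≋; sum-replicate-zero)
  open import Algebra.Properties.CommutativeSemigroup commutativeSemigroup using (xy∙z≈xz∙y; x∙yz≈xz∙y)
  open import Relation.Binary.Reasoning.Setoid setoid

  sum-extract : ∀ {n} (V : Vector Carrier (suc n)) i → sum V ≈ V i ∙ sum (updateAt V i (const ε))
  sum-extract {n} V i = begin
    sum V                                  ≈⟨ sum-remove V ⟩
    V i ∙ sum (removeAt V i)               ≈⟨ ∙-congˡ (identityˡ _) ⟨
    V i ∙ (ε ∙ sum (removeAt V i))         ≈⟨ ∙-congˡ (∙-cong (reflexive (updateAt-updates i V)) (sum-cong-≋ same-rest)) ⟨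
    V i ∙ (U i ∙ sum (removeAt U i))       ≈⟨ ∙-congˡ (sum-remove U) ⟨
    V i ∙ sum U                            ∎
    where
    U : Vector Carrier (suc n)
    U = updateAt V i (const ε)
    same-rest : ∀ j → removeAt U i j ≈ removeAt V i j
    same-rest j = reflexive (updateAt-minimal _ i V (punchInᵢ≢i i j))

  sum-single : ∀ {n} (V : Vector Carrier n) i → (∀ j → j ≢ i → V j ≈ ε) → sum V ≈ V i
  sum-single {suc n} V i V≈ε = begin
    sum V                      ≈⟨ sum-remove V ⟩
    V i ∙ sum (removeAt V i)   ≈⟨ ∙-congˡ (sum-cong-≋ (λ j → V≈ε _ (punchInᵢ≢i i j))) ⟩
    V i ∙ sum {n} (λ _ → ε)    ≈⟨ ∙-congˡ (sum-replicate-zero n) ⟩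
    V i ∙ ε                    ≈⟨ identityʳ _ ⟩
    V i                        ∎

  sum∙-cong-factor : ∀ {n} (V : Vector Carrier (suc n)) i {y y′} →
    V i ∙ y ≈ V i ∙ y′ → sum V ∙ y ≈ sum V ∙ y′
  sum∙-cong-factor V i {y} {y′} Vᵢy≈Vᵢy′ = begin
    sum V ∙ y                       ≈⟨ ∙-congʳ (sum-extract V i) ⟩
    (V i ∙ rest) ∙ y                ≈⟨ xy∙z≈xz∙y (V i) rest y ⟩
    (V i ∙ y) ∙ rest                ≈⟨ ∙-congʳ Vᵢy≈Vᵢy′ ⟩
    (V i ∙ y′) ∙ rest               ≈⟨ xy∙z≈xz∙y (V i) rest y′ ⟨
    (V i ∙ rest) ∙ y′               ≈⟨ ∙-congʳ (sum-extract V i) ⟨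
    sum V ∙ y′                      ∎
    where
    rest : Carrier
    rest = sum (updateAt V i (const ε))

  sum∙-cong-pointwise : ∀ {n} {V W : Vector Carrier n} {z} →
    (∀ i → V i ∙ z ≈ W i ∙ z) → sum V ∙ z ≈ sum W ∙ z
  sum∙-cong-pointwise {zero} _ = refl
  sum∙-cong-pointwise {suc n} {V} {W} {z} V≈W = begin
    (V zero ∙ sum (V ∘ suc)) ∙ z    ≈⟨ assoc _ _ _ ⟩
    V zero ∙ (sum (V ∘ suc) ∙ z)    ≈⟨ ∙-congˡ (sum∙-cong-pointwise (V≈W ∘ suc)) ⟩
    V zero ∙ (sum (W ∘ suc) ∙ z)    ≈⟨ x∙yz≈xz∙y (V zero) _ z ⟩
    (V zero ∙ z) ∙ sum (W ∘ suc)    ≈⟨ ∙-congʳ (V≈W zero) ⟩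
    (W zero ∙ z) ∙ sum (W ∘ suc)    ≈⟨ x∙yz≈xz∙y (W zero) _ z ⟨
    W zero ∙ (sum (W ∘ suc) ∙ z)    ≈⟨ assoc _ _ _ ⟨
    (W zero ∙ sum (W ∘ suc)) ∙ z    ∎

module CommutativeRingLemmas {c ℓ} (A : CommutativeRing c ℓ) where
  open CommutativeRing A
  open import Algebra.Properties.Semiring.Sum semiring using (sum; sum-syntax; sum-cong-≋; ∑-distrib-+; *-distribˡ-sum)
  open import Algebra.Properties.Semiring.Exp semiring using (_^_)
  open import Algebra.Properties.Ring ring using (-1*x≈-x)
  open import Algebra.Properties.CommutativeSemigroup *-commutativeSemigroup using (x∙yz≈y∙xz; xy∙z≈y∙xz)
  open import Relation.Binary.Reasoning.Setoid setoid

  -‿telescope : ∀ x y z → (x - y) + (y - z) ≈ x - z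
  -‿telescope x y z = begin
    (x - y) + (y - z)    ≈⟨ +-assoc x (- y) (y - z) ⟩
    x + (- y + (y - z))  ≈⟨ +-congˡ (+-assoc (- y) y (- z)) ⟨
    x + ((- y + y) - z)  ≈⟨ +-congˡ (+-congʳ (-‿inverseˡ y)) ⟩
    x + (0# - z)         ≈⟨ +-congˡ (+-identityˡ _) ⟩
    x - z                ∎

  -‿distrib-sum : ∀ {N} (v : Fin N → Carrier) → - sum v ≈ sum (λ k → - v k)
  -‿distrib-sum v = begin
    - sum v                   ≈⟨ -1*x≈-x _ ⟨
    - 1# * sum v              ≈⟨ *-distribˡ-sum (- 1#) v ⟩
    sum (λ k → - 1# * v k)    ≈⟨ sum-cong-≋ (λ k → -1*x≈-x (v k)) ⟩
    sum (λ k → - v k)         ∎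

  ∑-distrib-− : ∀ {N} (u v : Fin N → Carrier) → ∑[ k < N ] (u k - v k) ≈ sum u - sum v
  ∑-distrib-− u v = trans (∑-distrib-+ u (λ k → - v k)) (+-congˡ (sym (-‿distrib-sum v)))

  ∑-telescope : ∀ N (T : ℕ → Carrier) → ∑[ k < N ] (T (toℕ k) - T (suc (toℕ k))) ≈ T 0 - T N
  ∑-telescope zero    T = sym (-‿inverseʳ (T 0))
  ∑-telescope (suc N) T = begin
    (T 0 - T 1) + ∑[ k < N ] (T (suc (toℕ k)) - T (suc (suc (toℕ k))))  ≈⟨ +-congˡ (∑-telescope N (T ∘ suc)) ⟩
    (T 0 - T 1) + (T 1 - T (suc N))                                      ≈⟨ -‿telescope (T 0) (T 1) (T (suc N)) ⟩
    T 0 - T (suc N)                                                      ∎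

  ex≈ey⇒exᵏ≈eyᵏ : ∀ {e x y} → e * x ≈ e * y → ∀ k → e * x ^ k ≈ e * y ^ k
  ex≈ey⇒exᵏ≈eyᵏ ex≈ey zero = refl
  ex≈ey⇒exᵏ≈eyᵏ {e} {x} {y} ex≈ey (suc k) = begin
    e * (x * x ^ k)    ≈⟨ *-assoc e x (x ^ k) ⟨
    (e * x) * x ^ k    ≈⟨ *-congʳ ex≈ey ⟩
    (e * y) * x ^ k    ≈⟨ xy∙z≈y∙xz e y (x ^ k) ⟩
    y * (e * x ^ k)    ≈⟨ *-congˡ (ex≈ey⇒exᵏ≈eyᵏ ex≈ey k) ⟩
    y * (e * y ^ k)    ≈⟨ x∙yz≈y∙xz y e (y ^ k) ⟩
    e * (y * y ^ k)    ∎

  ex≈ey⇒ep[x]≈ep[y] : ∀ {e x y} → e * x ≈ e * y → ∀ {N} (p : Fin N → Carrier) →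
    e * ∑[ k < N ] (p k * x ^ toℕ k) ≈ e * ∑[ k < N ] (p k * y ^ toℕ k)
  ex≈ey⇒ep[x]≈ep[y] {e} {x} {y} ex≈ey p = begin
    e * ∑[ k < _ ] (p k * x ^ toℕ k)      ≈⟨ *-distribˡ-sum e (λ k → p k * x ^ toℕ k) ⟩
    ∑[ k < _ ] (e * (p k * x ^ toℕ k))    ≈⟨ sum-cong-≋ (λ k → trans (x∙yz≈y∙xz e (p k) _)
                                               (trans (*-congˡ (ex≈ey⇒exᵏ≈eyᵏ ex≈ey (toℕ k))) (x∙yz≈y∙xz (p k) e _))) ⟩
    ∑[ k < _ ] (e * (p k * y ^ toℕ k))    ≈⟨ *-distribˡ-sum e (λ k → p k * y ^ toℕ k) ⟨
    e * ∑[ k < _ ] (p k * y ^ toℕ k)      ∎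

module IdealQuotient {c ℓ} (R : CommutativeRing c ℓ) {g : ℕ} (gens : Fin g → CommutativeRing.Carrier R) where
  open CommutativeRing R
  open import Algebra.Properties.Semiring.Sum semiring
    using (sum; sum-cong-≋; ∑-distrib-+; *-distribˡ-sum; sum-replicate-zero)
  open CommutativeMonoidSum +-commutativeMonoid using (sum-single)
  open import Algebra.Properties.CommutativeSemigroup +-commutativeSemigroup using (interchange)
  open import Algebra.Properties.CommutativeSemigroup *-commutativeSemigroup using (x∙yz≈y∙xz)
  open import Algebra.Properties.Ring ring using (-1*x≈-x; x[y-z]≈xy-xz; [y-z]x≈yx-zx)
  open CommutativeRingLemmas R using (-‿telescope)
  open import Algebra.Properties.AbelianGroup +-abelianGroup using (⁻¹-anti-homo‿-; ⁻¹-∙-comm)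
  open import Algebra.Properties.Group +-group using (ε⁻¹≈ε)
  open import Relation.Binary.Reasoning.Setoid setoid

  InIdeal : Carrier → Set (c ⊔ ℓ)
  InIdeal z = Σ (Fin g → Carrier) λ h → z ≈ sum (λ i → gens i * h i)

  ideal-resp : ∀ {z z′} → z ≈ z′ → InIdeal z → InIdeal z′
  ideal-resp z≈z′ (h , z≈∑) = h , trans (sym z≈z′) z≈∑

  ideal-0 : InIdeal 0#
  ideal-0 = (λ _ → 0#) , sym (trans (sum-cong-≋ (λ i → zeroʳ (gens i))) (sum-replicate-zero g))

  ideal-+ : ∀ {z z′} → InIdeal z → InIdeal z′ → InIdeal (z + z′)
  ideal-+ (h , z≈∑) (h′ , z′≈∑′) = (λ i → h i + h′ i) , (begin
    _ + _                                                        ≈⟨ +-cong z≈∑ z′≈∑′ ⟩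
    sum (λ i → gens i * h i) + sum (λ i → gens i * h′ i)         ≈⟨ ∑-distrib-+ (λ i → gens i * h i) (λ i → gens i * h′ i) ⟨
    sum (λ i → gens i * h i + gens i * h′ i)                     ≈⟨ sum-cong-≋ (λ i → distribˡ (gens i) (h i) (h′ i)) ⟨
    sum (λ i → gens i * (h i + h′ i))                            ∎)

  ideal-* : ∀ a {z} → InIdeal z → InIdeal (a * z)
  ideal-* a (h , z≈∑) = (λ i → a * h i) , (begin
    a * _                              ≈⟨ *-congˡ z≈∑ ⟩
    a * sum (λ i → gens i * h i)       ≈⟨ *-distribˡ-sum a (λ i → gens i * h i) ⟩
    sum (λ i → a * (gens i * h i))     ≈⟨ sum-cong-≋ (λ i → x∙yz≈y∙xz a (gens i) (h i)) ⟩
    sum (λ i → gens i * (a * h i))     ∎)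

  ideal-gen : ∀ i → InIdeal (gens i)
  ideal-gen i = δ , sym (begin
    sum (λ j → gens j * δ j)   ≈⟨ sum-single (λ j → gens j * δ j) i off-i ⟩
    gens i * δ i               ≡⟨ ≡.cong (gens i *_) δᵢ≡1 ⟩
    gens i * 1#                ≈⟨ *-identityʳ _ ⟩
    gens i                     ∎)
    where
    δ : Fin g → Carrier
    δ j = if does (j ≟ i) then 1# else 0#
    δᵢ≡1 : δ i ≡ 1#
    δᵢ≡1 rewrite dec-true (i ≟ i) ≡.refl = ≡.refl
    off-i : ∀ j → j ≢ i → gens j * δ j ≈ 0#
    off-i j j≢i rewrite dec-false (j ≟ i) j≢i = zeroʳ _

  infix 4 _∼_
  _∼_ : Carrier → Carrier → Set (c ⊔ ℓ)
  x ∼ y = InIdeal (x - y)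

  ≈⇒∼ : ∀ {x y} → x ≈ y → x ∼ y
  ≈⇒∼ {x} {y} x≈y = ideal-resp (sym (trans (+-congʳ x≈y) (-‿inverseʳ y))) ideal-0

  ∼-sym : ∀ {x y} → x ∼ y → y ∼ x
  ∼-sym {x} {y} x∼y = ideal-resp (trans (-1*x≈-x _) (⁻¹-anti-homo‿- x y)) (ideal-* (- 1#) x∼y)

  ∼-trans : ∀ {x y z} → x ∼ y → y ∼ z → x ∼ z
  ∼-trans {x} {y} {z} x∼y y∼z = ideal-resp (-‿telescope x y z) (ideal-+ x∼y y∼z)

  +-cong∼ : ∀ {x x′ y y′} → x ∼ x′ → y ∼ y′ → x + y ∼ x′ + y′
  +-cong∼ {x} {x′} {y} {y′} x∼x′ y∼y′ = ideal-resp (begin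
    (x - x′) + (y - y′)      ≈⟨ interchange x (- x′) y (- y′) ⟩
    (x + y) + (- x′ - y′)    ≈⟨ +-congˡ (⁻¹-∙-comm x′ y′) ⟩
    (x + y) - (x′ + y′)      ∎) (ideal-+ x∼x′ y∼y′)

  *-cong∼ : ∀ {x x′ y y′} → x ∼ x′ → y ∼ y′ → x * y ∼ x′ * y′
  *-cong∼ {x} {x′} {y} {y′} x∼x′ y∼y′ = ideal-resp (begin
    y * (x - x′) + x′ * (y - y′)           ≈⟨ +-cong (trans (*-comm y _) ([y-z]x≈yx-zx y x x′)) (x[y-z]≈xy-xz x′ y y′) ⟩
    (x * y - x′ * y) + (x′ * y - x′ * y′)  ≈⟨ +-congˡ (+-congʳ (*-comm x′ y)) ⟩
    (x * y - x′ * y) + (y * x′ - x′ * y′)  ≈⟨ +-congʳ (+-congˡ (-‿cong (*-comm x′ y))) ⟩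
    (x * y - y * x′) + (y * x′ - x′ * y′)  ≈⟨ -‿telescope _ _ _ ⟩
    x * y - x′ * y′                        ∎) (ideal-+ (ideal-* y x∼x′) (ideal-* x′ y∼y′))

  -‿cong∼ : ∀ {x x′} → x ∼ x′ → - x ∼ - x′
  -‿cong∼ {x} {x′} x∼x′ = ideal-resp (+-cong (-1*x≈-x x) (-‿cong (-1*x≈-x x′))) (*-cong∼ {x = - 1#} (≈⇒∼ refl) x∼x′)

  gen∼0 : ∀ i → gens i ∼ 0#
  gen∼0 i = ideal-resp (sym (trans (+-congˡ ε⁻¹≈ε) (+-identityʳ _))) (ideal-gen i)

  quotient : CommutativeRing c (c ⊔ ℓ)
  quotient = record
    { _≈_ = _∼_ ; _+_ = _+_ ; _*_ = _*_ ; -_ = -_ ; 0# = 0# ; 1# = 1#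
    ; isCommutativeRing = record
      { isRing = record
        { +-isAbelianGroup = record
          { isGroup = record
            { isMonoid = record
              { isSemigroup = record
                { isMagma = record
                  { isEquivalence = record { refl = ≈⇒∼ refl ; sym = ∼-sym ; trans = ∼-trans }
                  ; ∙-cong = +-cong∼ }
                ; assoc = λ x y z → ≈⇒∼ (+-assoc x y z) }
              ; identity = ≈⇒∼ ∘ +-identityˡ , ≈⇒∼ ∘ +-identityʳ }
            ; inverse = ≈⇒∼ ∘ -‿inverseˡ , ≈⇒∼ ∘ -‿inverseʳ
            ; ⁻¹-cong = -‿cong∼ }
          ; comm = λ x y → ≈⇒∼ (+-comm x y) }
        ; *-cong = *-cong∼
        ; *-assoc = λ x y z → ≈⇒∼ (*-assoc x y z)
        ; *-identity = ≈⇒∼ ∘ *-identityˡ , ≈⇒∼ ∘ *-identityʳ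
        ; distrib = (λ x y z → ≈⇒∼ (distribˡ x y z)) , (λ x y z → ≈⇒∼ (distribʳ x y z)) }
      ; *-comm = λ x y → ≈⇒∼ (*-comm x y) } }

  private
    module Q = CommutativeRing quotient
  open import Algebra.Properties.Semiring.Exp semiring using (_^_)
  open import Algebra.Properties.CommutativeMonoid.Sum *-commutativeMonoid using () renaming (sum to ∏)
  open import Algebra.Properties.Semiring.Sum Q.semiring using () renaming (sum to sumᵠ)
  open import Algebra.Properties.Semiring.Exp Q.semiring using () renaming (_^_ to _^ᵠ_)
  open import Algebra.Properties.CommutativeMonoid.Sum Q.*-commutativeMonoid using () renaming (sum to ∏ᵠ)

  -- R and R/I share their operations, but the library's sum, product and power are indexed by the
  -- whole bundle, so the two versions agree only up to ∼.
  sum∼sumᵠ : ∀ {N} (v : Fin N → Carrier) → sum v ∼ sumᵠ v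
  sum∼sumᵠ {zero}  v = ≈⇒∼ refl
  sum∼sumᵠ {suc N} v = +-cong∼ (≈⇒∼ refl) (sum∼sumᵠ (v ∘ suc))

  ∏∼∏ᵠ : ∀ {N} (v : Fin N → Carrier) → ∏ v ∼ ∏ᵠ v
  ∏∼∏ᵠ {zero}  v = ≈⇒∼ refl
  ∏∼∏ᵠ {suc N} v = *-cong∼ (≈⇒∼ refl) (∏∼∏ᵠ (v ∘ suc))

  ^∼^ᵠ : ∀ x k → x ^ k ∼ x ^ᵠ k
  ^∼^ᵠ x zero    = ≈⇒∼ refl
  ^∼^ᵠ x (suc k) = *-cong∼ (≈⇒∼ refl) (^∼^ᵠ x k)

-- A forest on Fin (suc s) is stored as the map sending every vertex to the root of its tree;
-- the ℕ component of a State counts the inserted edges that closed a cycle.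
module UnionFind (s : ℕ) where
  open ≡ using (refl; sym; trans; cong; cong₂)
  open ℕΣ using (sum; sum-remove; sum-cong-≗; sum-replicate-zero)

  sum-bump : ∀ {n} (i : Fin (suc n)) (f g : Fin (suc n) → ℕ) →
    g i ≡ suc (f i) → (∀ j → j ≢ i → g j ≡ f j) → sum g ≡ suc (sum f)
  sum-bump i f g gᵢ≡1+fᵢ g≡f = begin
    sum g                            ≡⟨ sum-remove g ⟩
    g i ℕ.+ sum (removeAt g i)       ≡⟨ cong₂ ℕ._+_ gᵢ≡1+fᵢ (sum-cong-≗ (λ j → g≡f _ (punchInᵢ≢i i j))) ⟩
    suc (f i ℕ.+ sum (removeAt f i)) ≡⟨ cong suc (sum-remove f) ⟨
    suc (sum f)                      ∎
    where open ≡-Reasoning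

  Vertex : Set
  Vertex = Fin (suc s)

  RootMap : Set
  RootMap = Vertex → Vertex

  IsRootMap : RootMap → Set
  IsRootMap ρ = ∀ x → ρ (ρ x) ≡ ρ x

  redirect : Vertex → Vertex → Vertex → Vertex
  redirect A B y with y ≟ A
  ... | yes _ = B
  ... | no _  = y

  redirect-≡ : ∀ A B {y} → y ≡ A → redirect A B y ≡ B
  redirect-≡ A B {y} y≡A with y ≟ A
  ... | yes _ = refl
  ... | no y≢A = contradiction y≡A y≢A

  redirect-≢ : ∀ A B {y} → y ≢ A → redirect A B y ≡ y
  redirect-≢ A B {y} y≢A with y ≟ A
  ... | yes y≡A = contradiction y≡A y≢A
  ... | no _ = refl

  State : Set
  State = RootMap × ℕ

  unite : (ρ : RootMap) (u v : Vertex) → Dec (ρ u ≡ ρ v) → ℕ → State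
  unite ρ u v (yes _) cycles = ρ , suc cycles
  unite ρ u v (no _)  cycles = redirect (ρ u) (ρ v) ∘ ρ , cycles

  insert : Vertex → Vertex → State → State
  insert u v (ρ , cycles) = unite ρ u v (ρ u ≟ ρ v) cycles

  build : ∀ {k} → (Fin k → Vertex) → (Fin k → Vertex) → State
  build {zero}  α β = id , 0
  build {suc k} α β = insert (α zero) (β zero) (build (α ∘ suc) (β ∘ suc))

  roots : ∀ {k} → (Fin k → Vertex) → (Fin k → Vertex) → RootMap
  roots α β = proj₁ (build α β)

  cycles : ∀ {k} → (Fin k → Vertex) → (Fin k → Vertex) → ℕ
  cycles α β = proj₂ (build α β)

  unite-isRootMap : ∀ ρ u v d c → IsRootMap ρ → IsRootMap (proj₁ (unite ρ u v d c))
  unite-isRootMap ρ u v (yes _) c root = root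
  unite-isRootMap ρ u v (no A≢B) c root x = case (ρ x ≟ ρ u)
    where
    A B : Vertex
    A = ρ u
    B = ρ v
    case : Dec (ρ x ≡ A) → redirect A B (ρ (redirect A B (ρ x))) ≡ redirect A B (ρ x)
    case (yes ρx≡A) = begin
      redirect A B (ρ (redirect A B (ρ x))) ≡⟨ cong (redirect A B ∘ ρ) (redirect-≡ A B ρx≡A) ⟩
      redirect A B (ρ B)                    ≡⟨ cong (redirect A B) (root v) ⟩
      redirect A B B                        ≡⟨ redirect-≢ A B (A≢B ∘ sym) ⟩
      B                                     ≡⟨ redirect-≡ A B ρx≡A ⟨
      redirect A B (ρ x)                    ∎
      where open ≡-Reasoning
    case (no ρx≢A) = cong (redirect A B) (trans (cong ρ (redirect-≢ A B ρx≢A)) (root x))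

  unite-joins : ∀ ρ u v d c → let ρ′ = proj₁ (unite ρ u v d c) in
    ρ′ u ≡ ρ′ v × (∀ {x y} → ρ x ≡ ρ y → ρ′ x ≡ ρ′ y)
  unite-joins ρ u v (yes ρu≡ρv) c = ρu≡ρv , id
  unite-joins ρ u v (no A≢B) c =
    trans (redirect-≡ (ρ u) (ρ v) refl) (sym (redirect-≢ (ρ u) (ρ v) (A≢B ∘ sym))) , cong (redirect (ρ u) (ρ v))

  build-isRootMap : ∀ {k} (α β : Fin k → Vertex) → IsRootMap (roots α β)
  build-isRootMap {zero}  α β x = refl
  build-isRootMap {suc k} α β with build (α ∘ suc) (β ∘ suc) | build-isRootMap (α ∘ suc) (β ∘ suc)
  ... | ρ , c | root = unite-isRootMap ρ (α zero) (β zero) (ρ (α zero) ≟ ρ (β zero)) c root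

  build-joins : ∀ {k} (α β : Fin k → Vertex) i → roots α β (α i) ≡ roots α β (β i)
  build-joins {suc k} α β i with build (α ∘ suc) (β ∘ suc) | build-joins (α ∘ suc) (β ∘ suc)
  ... | ρ , c | joins with unite-joins ρ (α zero) (β zero) (ρ (α zero) ≟ ρ (β zero)) c | i
  ...   | joins-new , keeps-old | zero  = joins-new
  ...   | joins-new , keeps-old | suc i = keeps-old (joins i)

  connected⇒constant : ∀ {ρ : RootMap} (α β : Fin s → Vertex) → (∀ i → ρ (α i) ≡ ρ (β i)) →
    Connected α β → ∀ x → ρ x ≡ ρ zero
  connected⇒constant {ρ} α β joins connected x = fold (λ x y → ρ x ≡ ρ y) step refl (connected x zero)
    where
    step : ∀ {x y z} → Adj α β x y → ρ y ≡ ρ z → ρ x ≡ ρ z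
    step (i , inj₁ (refl , refl)) = trans (joins i)
    step (i , inj₂ (refl , refl)) = trans (sym (joins i))

  isNonroot : RootMap → Vertex → ℕ
  isNonroot ρ x = if does (ρ x ≟ x) then 0 else 1

  isNonroot-≡ : ∀ ρ {x} → ρ x ≡ x → isNonroot ρ x ≡ 0
  isNonroot-≡ ρ {x} ρx≡x rewrite dec-true (ρ x ≟ x) ρx≡x = refl

  isNonroot-≢ : ∀ ρ {x} → ρ x ≢ x → isNonroot ρ x ≡ 1
  isNonroot-≢ ρ {x} ρx≢x rewrite dec-false (ρ x ≟ x) ρx≢x = refl

  nonroots : RootMap → ℕ
  nonroots ρ = sum (isNonroot ρ)

  unite-nonroots : ∀ ρ u v d c → IsRootMap ρ → let (ρ′ , c′) = unite ρ u v d c in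
    c′ ℕ.+ nonroots ρ′ ≡ suc (c ℕ.+ nonroots ρ)
  unite-nonroots ρ u v (yes _) c root = refl
  unite-nonroots ρ u v (no A≢B) c root =
    trans (cong (c ℕ.+_) (sum-bump A (isNonroot ρ) (isNonroot ρ′) at-A elsewhere)) (ℕ.+-suc c _)
    where
    A B : Vertex
    A = ρ u
    B = ρ v
    ρ′ : RootMap
    ρ′ = redirect A B ∘ ρ
    at-A : isNonroot ρ′ A ≡ suc (isNonroot ρ A)
    at-A = begin
      isNonroot ρ′ A      ≡⟨ isNonroot-≢ ρ′ (λ ρ′A≡A → A≢B (trans (sym ρ′A≡A) (redirect-≡ A B (root u)))) ⟩
      1                   ≡⟨ cong suc (isNonroot-≡ ρ (root u)) ⟨
      suc (isNonroot ρ A) ∎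
      where open ≡-Reasoning
    elsewhere : ∀ x → x ≢ A → isNonroot ρ′ x ≡ isNonroot ρ x
    elsewhere x x≢A = case (ρ x ≟ A)
      where
      case : Dec (ρ x ≡ A) → isNonroot ρ′ x ≡ isNonroot ρ x
      case (no ρx≢A) = cong (λ y → if does (y ≟ x) then 0 else 1) (redirect-≢ A B ρx≢A)
      case (yes ρx≡A) = trans (isNonroot-≢ ρ′ B≢x) (sym (isNonroot-≢ ρ (λ ρx≡x → x≢A (trans (sym ρx≡x) ρx≡A))))
        where
        B≢x : ρ′ x ≢ x
        B≢x eq = A≢B (trans (sym ρx≡A) (trans (cong ρ (trans (sym eq) (redirect-≡ A B ρx≡A))) (root v)))

  build-nonroots : ∀ {k} (α β : Fin k → Vertex) → cycles α β ℕ.+ nonroots (roots α β) ≡ k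
  build-nonroots {zero} α β = trans (sum-cong-≗ {suc s} (λ x → isNonroot-≡ id {x} refl)) (sum-replicate-zero (suc s))
  build-nonroots {suc k} α β
    with build (α ∘ suc) (β ∘ suc) | build-isRootMap (α ∘ suc) (β ∘ suc) | build-nonroots (α ∘ suc) (β ∘ suc)
  ... | ρ , c | root | count =
    trans (unite-nonroots ρ (α zero) (β zero) (ρ (α zero) ≟ ρ (β zero)) c root) (cong suc count)

  nonroots-constant : ∀ {ρ : RootMap} R → (∀ x → ρ x ≡ R) → nonroots ρ ≡ s
  nonroots-constant {ρ} R ρ≡R =
    ℕ.suc-injective (trans (sym (sum-bump R (isNonroot ρ) (λ _ → 1) at-R elsewhere)) (sum-ones (suc s)))
    where
    at-R : 1 ≡ suc (isNonroot ρ R)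
    at-R = cong suc (sym (isNonroot-≡ ρ (ρ≡R R)))
    elsewhere : ∀ x → x ≢ R → 1 ≡ isNonroot ρ x
    elsewhere x x≢R = sym (isNonroot-≢ ρ (λ ρx≡x → x≢R (trans (sym ρx≡x) (ρ≡R x))))
    sum-ones : ∀ n → sum {n} (λ _ → 1) ≡ n
    sum-ones zero = refl
    sum-ones (suc n) = cong suc (sum-ones n)

  connected⇒acyclic : (α β : Fin s → Vertex) → Connected α β → cycles α β ≡ 0
  connected⇒acyclic α β connected = ℕ.+-cancelʳ-≡ _ _ 0 (trans (build-nonroots α β) (sym (nonroots-constant _ constant)))
    where
    constant : ∀ x → roots α β x ≡ roots α β zero
    constant = connected⇒constant α β (build-joins α β) connected

module SpanningTree {c ℓ} (M : CommutativeMonoid c ℓ) where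
  open CommutativeMonoid M
  open CommutativeMonoidSum M
  open import Algebra.Properties.CommutativeMonoid.Sum M
    using (sum-cong-≋; sum-init-last; sum-replicate-zero) renaming (sum to ∏)
  open import Relation.Binary.Reasoning.Setoid setoid

  module _ {s : ℕ} (E : Fin (suc s) → Fin (suc s) → Carrier)
    (E-sym : ∀ x y → E x y ≈ E y x)
    (E-slide : ∀ x y z → E y z ∙ E x y ≈ E y z ∙ E x z) where

    open UnionFind s

    link : Vertex → Vertex → Carrier
    link x y = if does (y ≟ x) then ε else E x y

    link-≡ : ∀ {x y} → y ≡ x → link x y ≈ ε
    link-≡ {x} {y} y≡x rewrite dec-true (y ≟ x) y≡x = refl

    link-≢ : ∀ {x y} → y ≢ x → link x y ≈ E x y
    link-≢ {x} {y} y≢x rewrite dec-false (y ≟ x) y≢x = refl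

    forest : RootMap → Carrier
    forest ρ = ∏ (λ x → link x (ρ x))

    forest-cong : ∀ {ρ ρ′} → (∀ x → ρ x ≡ ρ′ x) → forest ρ ≈ forest ρ′
    forest-cong ρ≗ρ′ = sum-cong-≋ (λ x → reflexive (≡.cong (link x) (ρ≗ρ′ x)))

    forest-slide : ∀ ρ x y → forest ρ ∙ E x y ≈ forest ρ ∙ E (ρ x) y
    forest-slide ρ x y with ρ x ≟ x
    ... | yes ρx≡x = ∙-congˡ (reflexive (≡.cong (λ z → E z y) (≡.sym ρx≡x)))
    ... | no ρx≢x = sum∙-cong-factor (λ z → link z (ρ z)) x (begin
      link x R ∙ E x y   ≈⟨ ∙-cong (link-≢ ρx≢x) (E-sym x y) ⟩
      E x R ∙ E y x      ≈⟨ E-slide y x R ⟩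
      E x R ∙ E y R      ≈⟨ ∙-cong (link-≢ ρx≢x) (E-sym R y) ⟨
      link x R ∙ E R y   ∎)
      where
      R : Vertex
      R = ρ x

    forest-redirect : ∀ ρ → IsRootMap ρ → ∀ {A B} → ρ A ≡ A → ρ B ≡ B → A ≢ B →
      forest ρ ∙ E A B ≈ forest (redirect A B ∘ ρ)
    forest-redirect ρ root {A} {B} ρA≡A ρB≡B A≢B = begin
      forest ρ ∙ E A B      ≈⟨ sum∙-cong-pointwise same ⟩
      ∏ W ∙ E A B           ≈⟨ comm _ _ ⟩
      E A B ∙ ∏ W           ≈⟨ ∙-congʳ (link-≢ {A} (A≢B ∘ ≡.sym)) ⟨
      link A B ∙ ∏ W        ≈⟨ ∙-congʳ (reflexive (≡.cong (link A) (redirect-≡ A B ρA≡A))) ⟨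
      V A ∙ ∏ W             ≈⟨ sum-extract V A ⟨
      forest ρ′             ∎
      where
      ρ′ : RootMap
      ρ′ = redirect A B ∘ ρ
      V W : Vertex → Carrier
      V x = link x (ρ′ x)
      W = updateAt V A (const ε)
      same : ∀ x → link x (ρ x) ∙ E A B ≈ W x ∙ E A B
      same x with x ≟ A
      ... | yes ≡.refl = ∙-congʳ (trans (link-≡ ρA≡A) (sym (reflexive (updateAt-updates A V))))
      ... | no x≢A = trans (moved (ρ x ≟ A)) (∙-congʳ (sym (reflexive (updateAt-minimal x A V x≢A))))
        where
        moved : Dec (ρ x ≡ A) → link x (ρ x) ∙ E A B ≈ V x ∙ E A B
        moved (no ρx≢A) = ∙-congʳ (reflexive (≡.cong (link x) (≡.sym (redirect-≢ A B ρx≢A))))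
        moved (yes ρx≡A) = begin
          link x (ρ x) ∙ E A B  ≈⟨ ∙-congʳ (reflexive (≡.cong (link x) ρx≡A)) ⟩
          link x A ∙ E A B      ≈⟨ ∙-congʳ (link-≢ (x≢A ∘ ≡.sym)) ⟩
          E x A ∙ E A B         ≈⟨ comm _ _ ⟩
          E A B ∙ E x A         ≈⟨ E-slide x A B ⟩
          E A B ∙ E x B         ≈⟨ comm _ _ ⟩
          E x B ∙ E A B         ≈⟨ ∙-congʳ (link-≢ B≢x) ⟨
          link x B ∙ E A B      ≈⟨ ∙-congʳ (reflexive (≡.cong (link x) (redirect-≡ A B ρx≡A))) ⟨
          V x ∙ E A B           ∎
          where
          B≢x : B ≢ x
          B≢x B≡x = A≢B (≡.trans (≡.sym ρx≡A) (≡.trans (≡.cong ρ (≡.sym B≡x)) ρB≡B))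

    forest-insert : ∀ ρ → IsRootMap ρ → ∀ u v → ρ u ≢ ρ v →
      E u v ∙ forest ρ ≈ forest (redirect (ρ u) (ρ v) ∘ ρ)
    forest-insert ρ root u v A≢B = begin
      E u v ∙ forest ρ        ≈⟨ comm _ _ ⟩
      forest ρ ∙ E u v        ≈⟨ forest-slide ρ u v ⟩
      forest ρ ∙ E A v        ≈⟨ ∙-congˡ (E-sym A v) ⟩
      forest ρ ∙ E v A        ≈⟨ forest-slide ρ v A ⟩
      forest ρ ∙ E B A        ≈⟨ ∙-congˡ (E-sym B A) ⟩
      forest ρ ∙ E A B        ≈⟨ forest-redirect ρ root (root u) (root v) A≢B ⟩
      forest (redirect A B ∘ ρ) ∎
      where
      A B : Vertex
      A = ρ u
      B = ρ v

    unite-forest : ∀ ρ u v d c → IsRootMap ρ → proj₂ (unite ρ u v d c) ≡ 0 →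
      ∀ {P} → (c ≡ 0 → P ≈ forest ρ) → E u v ∙ P ≈ forest (proj₁ (unite ρ u v d c))
    unite-forest ρ u v (no ρu≢ρv) c root c≡0 P≈forest =
      trans (∙-congˡ (P≈forest c≡0)) (forest-insert ρ root u v ρu≢ρv)

    build-forest : ∀ {k} (α β : Fin k → Vertex) → cycles α β ≡ 0 →
      ∏ (λ i → E (α i) (β i)) ≈ forest (roots α β)
    build-forest {zero} α β _ = sym (trans (sum-cong-≋ {suc s} (λ x → link-≡ {x} ≡.refl)) (sum-replicate-zero (suc s)))
    build-forest {suc k} α β
      with build (α ∘ suc) (β ∘ suc) | build-isRootMap (α ∘ suc) (β ∘ suc) | build-forest (α ∘ suc) (β ∘ suc)
    ... | ρ , c | root | ih = λ acyclic → unite-forest ρ (α zero) (β zero) (ρ (α zero) ≟ ρ (β zero)) c root acyclic ih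

    forest-reroot : ∀ R R′ → forest (const R) ≈ forest (const R′)
    forest-reroot R R′ with R ≟ R′
    ... | yes ≡.refl = refl
    ... | no R≢R′ = begin
      forest (const R)        ≈⟨ sum-extract V R′ ⟩
      V R′ ∙ ∏ V₁             ≈⟨ ∙-cong (link-≢ R≢R′) refl ⟩
      E R′ R ∙ ∏ V₁           ≈⟨ ∙-cong (E-sym R′ R) refl ⟩
      E R R′ ∙ ∏ V₁           ≈⟨ comm _ _ ⟩
      ∏ V₁ ∙ E R R′           ≈⟨ sum∙-cong-pointwise same ⟩
      ∏ W₁ ∙ E R R′           ≈⟨ comm _ _ ⟩
      E R R′ ∙ ∏ W₁           ≈⟨ ∙-cong (link-≢ (R≢R′ ∘ ≡.sym)) refl ⟨
      W R ∙ ∏ W₁              ≈⟨ sum-extract W R ⟨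
      forest (const R′)       ∎
      where
      V W V₁ W₁ : Vertex → Carrier
      V x = link x R
      W x = link x R′
      V₁ = updateAt V R′ (const ε)
      W₁ = updateAt W R (const ε)
      same : ∀ x → V₁ x ∙ E R R′ ≈ W₁ x ∙ E R R′
      same x with x ≟ R′ | x ≟ R
      ... | yes ≡.refl | _ = ∙-congʳ (begin
        V₁ R′     ≈⟨ reflexive (updateAt-updates R′ V) ⟩
        ε         ≈⟨ link-≡ ≡.refl ⟨
        W R′      ≈⟨ reflexive (updateAt-minimal R′ R W (R≢R′ ∘ ≡.sym)) ⟨
        W₁ R′     ∎)
      ... | no x≢R′ | yes ≡.refl = ∙-congʳ (begin
        V₁ R      ≈⟨ reflexive (updateAt-minimal R R′ V x≢R′) ⟩
        V R       ≈⟨ link-≡ ≡.refl ⟩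
        ε         ≈⟨ reflexive (updateAt-updates R W) ⟨
        W₁ R      ∎)
      ... | no x≢R′ | no x≢R = begin
        V₁ x ∙ E R R′   ≈⟨ ∙-congʳ (trans (reflexive (updateAt-minimal x R′ V x≢R′)) (link-≢ (x≢R ∘ ≡.sym))) ⟩
        E x R ∙ E R R′  ≈⟨ comm _ _ ⟩
        E R R′ ∙ E x R  ≈⟨ E-slide x R R′ ⟩
        E R R′ ∙ E x R′ ≈⟨ comm _ _ ⟩
        E x R′ ∙ E R R′ ≈⟨ ∙-congʳ (trans (reflexive (updateAt-minimal x R W x≢R)) (link-≢ (x≢R′ ∘ ≡.sym))) ⟨
        W₁ x ∙ E R R′   ∎

    forest-star : forest (const (fromℕ s)) ≈ ∏ (λ j → E (inject₁ j) (fromℕ s))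
    forest-star = begin
      forest (const (fromℕ s))
        ≈⟨ sum-init-last (λ x → link x (fromℕ s)) ⟩
      ∏ (λ j → link (inject₁ j) (fromℕ s)) ∙ link (fromℕ s) (fromℕ s)
        ≈⟨ ∙-cong (sum-cong-≋ (λ j → link-≢ (fromℕ≢inject₁ {i = j}))) (link-≡ ≡.refl) ⟩
      ∏ (λ j → E (inject₁ j) (fromℕ s)) ∙ ε
        ≈⟨ identityʳ _ ⟩
      ∏ (λ j → E (inject₁ j) (fromℕ s)) ∎

    spanningTree≈star : (α β : Fin s → Vertex) → Connected α β →
      ∏ (λ i → E (α i) (β i)) ≈ ∏ (λ j → E (inject₁ j) (fromℕ s))
    spanningTree≈star α β connected = begin
      ∏ (λ i → E (α i) (β i))          ≈⟨ build-forest α β (connected⇒acyclic α β connected) ⟩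
      forest (roots α β)               ≈⟨ forest-cong (connected⇒constant {roots α β} α β (build-joins α β) connected) ⟩
      forest (const (roots α β zero))  ≈⟨ forest-reroot _ (fromℕ s) ⟩
      forest (const (fromℕ s))         ≈⟨ forest-star ⟩
      ∏ (λ j → E (inject₁ j) (fromℕ s)) ∎

module SeriesAlgebra {c ℓ} (R : CommutativeRing c ℓ) where
  open CommutativeRing R renaming (Carrier to K) hiding (zero)
  open Poly R
  open import Relation.Binary.Reasoning.Setoid setoid
  open import Algebra.Properties.CommutativeSemigroup +-commutativeSemigroup using (interchange)
  open import Algebra.Properties.Group +-group using (ε⁻¹≈ε)
  open import Algebra.Properties.Ring ring using (-1*x≈-x)
  open import Algebra.Properties.Semiring.Sum semiring using (sum)

  sumLT-cong-< : ∀ N {h h′ : ℕ → K} → (∀ k → k < N → h k ≈ h′ k) → sumLT N h ≈ sumLT N h′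
  sumLT-cong-< zero    h≈h′ = refl
  sumLT-cong-< (suc N) h≈h′ = +-cong (sumLT-cong-< N (λ k k<N → h≈h′ k (ℕ.m<n⇒m<1+n k<N))) (h≈h′ N ℕ.≤-refl)

  sumLT-cong : ∀ N {h h′ : ℕ → K} → (∀ k → h k ≈ h′ k) → sumLT N h ≈ sumLT N h′
  sumLT-cong N h≈h′ = sumLT-cong-< N (λ k _ → h≈h′ k)

  sumLT-zero : ∀ N {h : ℕ → K} → (∀ k → k < N → h k ≈ 0#) → sumLT N h ≈ 0#
  sumLT-zero zero    h≈0 = refl
  sumLT-zero (suc N) h≈0 = trans (+-cong (sumLT-zero N (λ k k<N → h≈0 k (ℕ.m<n⇒m<1+n k<N))) (h≈0 N ℕ.≤-refl)) (+-identityˡ 0#)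

  sumLT-+ : ∀ N (h h′ : ℕ → K) → sumLT N (λ k → h k + h′ k) ≈ sumLT N h + sumLT N h′
  sumLT-+ zero    h h′ = sym (+-identityˡ 0#)
  sumLT-+ (suc N) h h′ = trans (+-congʳ (sumLT-+ N h h′)) (interchange _ _ _ _)

  *-distribˡ-sumLT : ∀ N x (h : ℕ → K) → x * sumLT N h ≈ sumLT N (λ k → x * h k)
  *-distribˡ-sumLT zero    x h = zeroʳ x
  *-distribˡ-sumLT (suc N) x h = trans (distribˡ x _ _) (+-congʳ (*-distribˡ-sumLT N x h))

  *-distribʳ-sumLT : ∀ N x (h : ℕ → K) → sumLT N h * x ≈ sumLT N (λ k → h k * x)
  *-distribʳ-sumLT zero    x h = zeroˡ x
  *-distribʳ-sumLT (suc N) x h = trans (distribʳ x _ _) (+-congʳ (*-distribʳ-sumLT N x h))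

  sumLT-single : ∀ N j {h : ℕ → K} → j < N → (∀ k → k < N → k ≢ j → h k ≈ 0#) → sumLT N h ≈ h j
  sumLT-single (suc N) j j<1+N h≈0 with j ℕ.≟ N
  ... | yes ≡.refl = trans (+-congʳ (sumLT-zero N (λ k k<N → h≈0 k (ℕ.m<n⇒m<1+n k<N) (ℕ.<⇒≢ k<N)))) (+-identityˡ _)
  ... | no j≢N = trans (+-cong (sumLT-single N j (ℕ.≤∧≢⇒< (ℕ.≤-pred j<1+N) j≢N) (λ k k<N → h≈0 k (ℕ.m<n⇒m<1+n k<N)))
                               (h≈0 N ℕ.≤-refl (j≢N ∘ ≡.sym)))
                       (+-identityʳ _)

  sumLT-sucˡ : ∀ N (h : ℕ → K) → sumLT (suc N) h ≈ h 0 + sumLT N (h ∘ suc)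
  sumLT-sucˡ zero    h = trans (+-identityˡ _) (sym (+-identityʳ _))
  sumLT-sucˡ (suc N) h = trans (+-congʳ (sumLT-sucˡ N h)) (+-assoc _ _ _)

  sumLT-reverse : ∀ M (h : ℕ → K) → sumLT (suc M) h ≈ sumLT (suc M) (λ i → h (M ∸ i))
  sumLT-reverse zero    h = refl
  sumLT-reverse (suc M) h = begin
    sumLT (suc M) h + h (suc M)                  ≈⟨ +-congʳ (sumLT-reverse M h) ⟩
    sumLT (suc M) (λ i → h (M ∸ i)) + h (suc M)  ≈⟨ +-comm _ _ ⟩
    h (suc M) + sumLT (suc M) (λ i → h (M ∸ i))  ≈⟨ sumLT-sucˡ (suc M) (λ i → h (suc M ∸ i)) ⟨
    sumLT (suc (suc M)) (λ i → h (suc M ∸ i))    ∎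

  sumLT-≡ : ∀ {N N′} (h : ℕ → K) → N ≡ N′ → sumLT N h ≈ sumLT N′ h
  sumLT-≡ h ≡.refl = refl

  sumLT-triangle : ∀ M (G : ℕ → ℕ → K) →
    sumLT (suc M) (λ a → sumLT (suc a) (G a)) ≈
    sumLT (suc M) (λ b → sumLT (suc (M ∸ b)) (λ c → G (b ℕ.+ c) b))
  sumLT-triangle zero    G = refl
  sumLT-triangle (suc M) G = begin
    sumLT (suc M) (λ a → sumLT (suc a) (G a)) + sumLT (suc (suc M)) (G (suc M))
      ≈⟨ +-congʳ (sumLT-triangle M G) ⟩
    sumLT (suc M) column + (sumLT (suc M) (G (suc M)) + G (suc M) (suc M))
      ≈⟨ +-assoc _ _ _ ⟨
    (sumLT (suc M) column + sumLT (suc M) (G (suc M))) + G (suc M) (suc M)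
      ≈⟨ +-congʳ (sumLT-+ (suc M) column (G (suc M))) ⟨
    sumLT (suc M) (λ b → column b + G (suc M) b) + G (suc M) (suc M)
      ≈⟨ +-cong (sumLT-cong-< (suc M) extend) corner ⟩
    sumLT (suc M) column′ + column′ (suc M) ∎
    where
    column column′ : ℕ → K
    column  b = sumLT (suc (M ∸ b)) (λ c → G (b ℕ.+ c) b)
    column′ b = sumLT (suc (suc M ∸ b)) (λ c → G (b ℕ.+ c) b)
    extend : ∀ b → b < suc M → column b + G (suc M) b ≈ column′ b
    extend b b<1+M = sym (trans (sumLT-≡ (λ c → G (b ℕ.+ c) b) (≡.cong suc (ℕ.+-∸-assoc 1 b≤M)))
      (+-congˡ (reflexive (≡.cong (λ a → G a b) (≡.trans (ℕ.+-suc b (M ∸ b)) (≡.cong suc (ℕ.m+[n∸m]≡n b≤M)))))))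
      where
      b≤M : b ≤ M
      b≤M = ℕ.≤-pred b<1+M
    corner : G (suc M) (suc M) ≈ column′ (suc M)
    corner = sym (trans (sumLT-≡ (λ c → G (suc M ℕ.+ c) (suc M)) (≡.cong suc (ℕ.n∸n≡0 M)))
      (trans (+-identityˡ _) (reflexive (≡.cong (λ a → G a (suc M)) (ℕ.+-identityʳ (suc M))))))

  sumFin≈sum : ∀ {k} (v : Fin k → K) → sumFin v ≈ sum v
  sumFin≈sum {zero}  v = refl
  sumFin≈sum {suc k} v = +-congˡ (sumFin≈sum (v ∘ suc))

  sumFin-cong : ∀ {k} {v w : Fin k → K} → (∀ i → v i ≈ w i) → sumFin v ≈ sumFin w
  sumFin-cong {zero}  v≈w = refl
  sumFin-cong {suc k} v≈w = +-cong (v≈w zero) (sumFin-cong (v≈w ∘ suc))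

  infix 4 _≤ᵐ_
  infixl 6 _+ᵐ_ _∸ᵐ_

  _≤ᵐ_ : ∀ {r} → Mon r → Mon r → Set
  a ≤ᵐ m = ∀ i → a i ≤ m i

  _∸ᵐ_ : ∀ {r} → Mon r → Mon r → Mon r
  (m ∸ᵐ a) i = m i ∸ a i

  _+ᵐ_ : ∀ {r} → Mon r → Mon r → Mon r
  (m +ᵐ a) i = m i ℕ.+ a i

  -- monomials are functions, so coefficient functions need not respect pointwise equality of exponents
  Extensional : ∀ {r} → (Mon r → K) → Set ℓ
  Extensional g = ∀ {m m′} → m ≗ m′ → g m ≈ g m′

  cons-cong : ∀ {r k k′} {a a′ : Mon r} → k ≡ k′ → a ≗ a′ → cons k a ≗ cons k′ a′
  cons-cong k≡k′ a≗a′ zero    = k≡k′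
  cons-cong k≡k′ a≗a′ (suc i) = a≗a′ i

  cons-tl : ∀ {r} (m : Mon (suc r)) → cons (m zero) (tl m) ≗ m
  cons-tl m zero    = ≡.refl
  cons-tl m (suc i) = ≡.refl

  cons-≤ᵐ : ∀ {r k} {a : Mon r} (m : Mon (suc r)) → k ≤ m zero → a ≤ᵐ tl m → cons k a ≤ᵐ m
  cons-≤ᵐ m k≤ a≤ zero    = k≤
  cons-≤ᵐ m k≤ a≤ (suc i) = a≤ i

  sumBelow-cong-≤ : ∀ {r} (m : Mon r) {g g′ : Mon r → K} → (∀ a → a ≤ᵐ m → g a ≈ g′ a) → sumBelow m g ≈ sumBelow m g′
  sumBelow-cong-≤ {zero}  m g≈g′ = g≈g′ _ (λ ())
  sumBelow-cong-≤ {suc r} m g≈g′ = sumLT-cong-< (suc (m zero)) (λ k k≤ →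
    sumBelow-cong-≤ (tl m) (λ a a≤ → g≈g′ (cons k a) (cons-≤ᵐ m (ℕ.≤-pred k≤) a≤)))

  sumBelow-cong : ∀ {r} (m : Mon r) {g g′ : Mon r → K} → (∀ a → g a ≈ g′ a) → sumBelow m g ≈ sumBelow m g′
  sumBelow-cong m g≈g′ = sumBelow-cong-≤ m (λ a _ → g≈g′ a)

  sumBelow-bound : ∀ {r} {m m′ : Mon r} (g : Mon r → K) → m ≗ m′ → sumBelow m g ≈ sumBelow m′ g
  sumBelow-bound {zero}  g m≗m′ = refl
  sumBelow-bound {suc r} {m} {m′} g m≗m′ rewrite m≗m′ zero =
    sumLT-cong (suc (m′ zero)) (λ k → sumBelow-bound (λ a → g (cons k a)) (m≗m′ ∘ suc))

  sumBelow-zero : ∀ {r} (m : Mon r) {g : Mon r → K} → (∀ a → a ≤ᵐ m → g a ≈ 0#) → sumBelow m g ≈ 0#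
  sumBelow-zero {zero}  m g≈0 = g≈0 _ (λ ())
  sumBelow-zero {suc r} m g≈0 = sumLT-zero (suc (m zero)) (λ k k≤ →
    sumBelow-zero (tl m) (λ a a≤ → g≈0 (cons k a) (cons-≤ᵐ m (ℕ.≤-pred k≤) a≤)))

  sumBelow-+ : ∀ {r} (m : Mon r) (g g′ : Mon r → K) → sumBelow m (λ a → g a + g′ a) ≈ sumBelow m g + sumBelow m g′
  sumBelow-+ {zero}  m g g′ = refl
  sumBelow-+ {suc r} m g g′ = trans (sumLT-cong (suc (m zero)) (λ k → sumBelow-+ (tl m) (g ∘ cons k) (g′ ∘ cons k)))
                                    (sumLT-+ (suc (m zero)) _ _)

  *-distribˡ-sumBelow : ∀ {r} (m : Mon r) x (g : Mon r → K) → x * sumBelow m g ≈ sumBelow m (λ a → x * g a)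
  *-distribˡ-sumBelow {zero}  m x g = refl
  *-distribˡ-sumBelow {suc r} m x g = trans (*-distribˡ-sumLT (suc (m zero)) x _)
    (sumLT-cong (suc (m zero)) (λ k → *-distribˡ-sumBelow (tl m) x (g ∘ cons k)))

  *-distribʳ-sumBelow : ∀ {r} (m : Mon r) x (g : Mon r → K) → sumBelow m g * x ≈ sumBelow m (λ a → g a * x)
  *-distribʳ-sumBelow {zero}  m x g = refl
  *-distribʳ-sumBelow {suc r} m x g = trans (*-distribʳ-sumLT (suc (m zero)) x _)
    (sumLT-cong (suc (m zero)) (λ k → *-distribʳ-sumBelow (tl m) x (g ∘ cons k)))

  sumBelow-sumLT : ∀ {r} (m : Mon r) N (h : Mon r → ℕ → K) →
    sumBelow m (λ a → sumLT N (h a)) ≈ sumLT N (λ k → sumBelow m (λ a → h a k))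
  sumBelow-sumLT m zero    h = sumBelow-zero m (λ _ _ → refl)
  sumBelow-sumLT m (suc N) h = trans (sumBelow-+ m _ _) (+-congʳ (sumBelow-sumLT m N h))

  sumBelow-single : ∀ {r} (m a⋆ : Mon r) {g : Mon r → K} → a⋆ ≤ᵐ m → Extensional g →
    (∀ a → a ≤ᵐ m → ∃ (λ i → a i ≢ a⋆ i) → g a ≈ 0#) → sumBelow m g ≈ g a⋆
  sumBelow-single {zero}  m a⋆ a⋆≤m ext g≈0 = ext (λ ())
  sumBelow-single {suc r} m a⋆ {g} a⋆≤m ext g≈0 = begin
    sumBelow m g
      ≈⟨ sumLT-single (suc (m zero)) (a⋆ zero) (s≤s (a⋆≤m zero)) off-row ⟩
    sumBelow (tl m) (λ a → g (cons (a⋆ zero) a))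
      ≈⟨ sumBelow-single (tl m) (tl a⋆) (a⋆≤m ∘ suc) (ext ∘ cons-cong ≡.refl) in-row ⟩
    g (cons (a⋆ zero) (tl a⋆))
      ≈⟨ ext (cons-tl a⋆) ⟩
    g a⋆ ∎
    where
    off-row : ∀ k → k < suc (m zero) → k ≢ a⋆ zero → sumBelow (tl m) (λ a → g (cons k a)) ≈ 0#
    off-row k k≤ k≢ = sumBelow-zero (tl m) (λ a a≤ → g≈0 (cons k a) (cons-≤ᵐ m (ℕ.≤-pred k≤) a≤) (zero , k≢))
    in-row : ∀ a → a ≤ᵐ tl m → ∃ (λ i → a i ≢ tl a⋆ i) → g (cons (a⋆ zero) a) ≈ 0#
    in-row a a≤ (i , aᵢ≢) = g≈0 (cons (a⋆ zero) a) (cons-≤ᵐ m (a⋆≤m zero) a≤) (suc i , aᵢ≢)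

  sumBelow-reverse : ∀ {r} (m : Mon r) (g : Mon r → K) → Extensional g → sumBelow m g ≈ sumBelow m (λ a → g (m ∸ᵐ a))
  sumBelow-reverse {zero}  m g ext = ext (λ ())
  sumBelow-reverse {suc r} m g ext = begin
    sumLT (suc (m zero)) (λ k → sumBelow (tl m) (g ∘ cons k))
      ≈⟨ sumLT-cong (suc (m zero)) (λ k → sumBelow-reverse (tl m) (g ∘ cons k) (ext ∘ cons-cong ≡.refl)) ⟩
    sumLT (suc (m zero)) (λ k → sumBelow (tl m) (λ a → g (cons k (tl m ∸ᵐ a))))
      ≈⟨ sumLT-reverse (m zero) _ ⟩
    sumLT (suc (m zero)) (λ k → sumBelow (tl m) (λ a → g (cons (m zero ∸ k) (tl m ∸ᵐ a))))
      ≈⟨ sumLT-cong (suc (m zero)) (λ k → sumBelow-cong (tl m) (λ a → ext λ { zero → ≡.refl ; (suc i) → ≡.refl })) ⟩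
    sumBelow m (λ a → g (m ∸ᵐ a)) ∎

  sumBelow-triangle : ∀ {r} (m : Mon r) (G : Mon r → Mon r → K) →
    (∀ {a a′ b b′} → a ≗ a′ → b ≗ b′ → G a b ≈ G a′ b′) →
    sumBelow m (λ a → sumBelow a (G a)) ≈ sumBelow m (λ b → sumBelow (m ∸ᵐ b) (λ c → G (b +ᵐ c) b))
  sumBelow-triangle {zero}  m G ext = ext (λ ()) (λ ())
  sumBelow-triangle {suc r} m G ext = begin
    sumLT (suc (m zero)) (λ a₀ → sumBelow (tl m) (λ a → sumLT (suc a₀) (λ b₀ → sumBelow a (λ b → G (cons a₀ a) (cons b₀ b)))))
      ≈⟨ sumLT-cong (suc (m zero)) (λ a₀ → sumBelow-sumLT (tl m) (suc a₀) _) ⟩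
    sumLT (suc (m zero)) (λ a₀ → sumLT (suc a₀) (λ b₀ → sumBelow (tl m) (λ a → sumBelow a (λ b → G (cons a₀ a) (cons b₀ b)))))
      ≈⟨ sumLT-cong (suc (m zero)) (λ a₀ → sumLT-cong (suc a₀) (λ b₀ →
           sumBelow-triangle (tl m) (λ a b → G (cons a₀ a) (cons b₀ b))
             (λ a≗ b≗ → ext (cons-cong ≡.refl a≗) (cons-cong ≡.refl b≗)))) ⟩
    sumLT (suc (m zero)) (λ a₀ → sumLT (suc a₀) (λ b₀ → H a₀ b₀))
      ≈⟨ sumLT-triangle (m zero) H ⟩
    sumLT (suc (m zero)) (λ b₀ → sumLT (suc (m zero ∸ b₀)) (λ c₀ → H (b₀ ℕ.+ c₀) b₀))
      ≈⟨ sumLT-cong (suc (m zero)) (λ b₀ → trans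
           (sumLT-cong (suc (m zero ∸ b₀)) (λ c₀ → sumBelow-cong (tl m) (λ b → sumBelow-cong (tl m ∸ᵐ b) (λ c →
              ext (λ { zero → ≡.refl ; (suc i) → ≡.refl }) (λ _ → ≡.refl)))))
           (sym (sumBelow-sumLT (tl m) (suc (m zero ∸ b₀)) _))) ⟩
    sumBelow m (λ b → sumBelow (m ∸ᵐ b) (λ c → G (b +ᵐ c) b)) ∎
    where
    H : ℕ → ℕ → K
    H a₀ b₀ = sumBelow (tl m) (λ b → sumBelow (tl m ∸ᵐ b) (λ c → G (cons a₀ (b +ᵐ c)) (cons b₀ b)))

  infixl 6 _+ₚ_

  _+ₚ_ : ∀ {r} → Series r → Series r → Series r
  (P +ₚ Q) m = P m + Q m

  -ₚ_ : ∀ {r} → Series r → Series r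
  (-ₚ P) m = - P m

  0ₚ : ∀ {r} → Series r
  0ₚ m = 0#

  constP-extensional : ∀ {r} x → Extensional {r} (constP x)
  constP-extensional {zero}  x m≗m′ = refl
  constP-extensional {suc r} x {m} {m′} m≗m′ with m zero | m′ zero | m≗m′ zero
  ... | zero  | zero  | _ = constP-extensional x (m≗m′ ∘ suc)
  ... | suc _ | suc _ | _ = refl

  constP-cong : ∀ {r} {x y} → x ≈ y → constP {r} x ≈ₚ constP y
  constP-cong {zero}  x≈y m = x≈y
  constP-cong {suc r} x≈y m with m zero
  ... | zero  = constP-cong x≈y (tl m)
  ... | suc _ = refl

  constP-at-0 : ∀ {r} x → constP {r} x (λ _ → 0) ≈ x
  constP-at-0 {zero}  x = refl
  constP-at-0 {suc r} x = constP-at-0 {r} x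

  constP-off-0 : ∀ {r} x (m : Mon r) i → m i ≢ 0 → constP x m ≈ 0#
  constP-off-0 {suc r} x m zero m₀≢0 with m zero
  ... | zero  = contradiction ≡.refl m₀≢0
  ... | suc _ = refl
  constP-off-0 {suc r} x m (suc i) mᵢ≢0 with m zero
  ... | zero  = constP-off-0 x (tl m) i mᵢ≢0
  ... | suc _ = refl

  *ₚ-cong : ∀ {r} {P P′ Q Q′ : Series r} → P ≈ₚ P′ → Q ≈ₚ Q′ → (P *ₚ Q) ≈ₚ (P′ *ₚ Q′)
  *ₚ-cong P≈P′ Q≈Q′ m = sumBelow-cong m (λ a → *-cong (P≈P′ a) (Q≈Q′ _))

  *ₚ-extensional : ∀ {r} {P Q : Series r} → Extensional P → Extensional Q → Extensional (P *ₚ Q)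
  *ₚ-extensional {P = P} {Q} extP extQ {m} {m′} m≗m′ =
    trans (sumBelow-bound (λ a → P a * Q (m ∸ᵐ a)) m≗m′)
          (sumBelow-cong m′ (λ a → *-congˡ (extQ (λ i → ≡.cong (_∸ a i) (m≗m′ i)))))

  *ₚ-comm : ∀ {r} {P Q : Series r} → Extensional P → Extensional Q → (P *ₚ Q) ≈ₚ (Q *ₚ P)
  *ₚ-comm {P = P} {Q} extP extQ m = trans
    (sumBelow-reverse m (λ a → P a * Q (m ∸ᵐ a)) (λ a≗ → *-cong (extP a≗) (extQ (λ i → ≡.cong (m i ∸_) (a≗ i)))))
    (sumBelow-cong-≤ m (λ a a≤m → trans (*-comm _ _) (*-congʳ (extQ (λ i → ℕ.m∸[m∸n]≡n (a≤m i))))))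

  *ₚ-assoc : ∀ {r} {P Q S : Series r} → Extensional P → Extensional Q → Extensional S →
    ((P *ₚ Q) *ₚ S) ≈ₚ (P *ₚ (Q *ₚ S))
  *ₚ-assoc {P = P} {Q} {S} extP extQ extS m = begin
    sumBelow m (λ a → sumBelow a (λ b → P b * Q (a ∸ᵐ b)) * S (m ∸ᵐ a))
      ≈⟨ sumBelow-cong m (λ a → *-distribʳ-sumBelow a (S (m ∸ᵐ a)) _) ⟩
    sumBelow m (λ a → sumBelow a (λ b → P b * Q (a ∸ᵐ b) * S (m ∸ᵐ a)))
      ≈⟨ sumBelow-triangle m (λ a b → P b * Q (a ∸ᵐ b) * S (m ∸ᵐ a)) (λ a≗ b≗ →
           *-cong (*-cong (extP b≗) (extQ (λ i → ≡.cong₂ _∸_ (a≗ i) (b≗ i)))) (extS (λ i → ≡.cong (m i ∸_) (a≗ i)))) ⟩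
    sumBelow m (λ b → sumBelow (m ∸ᵐ b) (λ c → P b * Q (b +ᵐ c ∸ᵐ b) * S (m ∸ᵐ (b +ᵐ c))))
      ≈⟨ sumBelow-cong m (λ b → sumBelow-cong (m ∸ᵐ b) (λ c → trans (*-assoc _ _ _) (*-congˡ (*-cong
           (extQ (λ i → ℕ.m+n∸m≡n (b i) (c i))) (extS (λ i → ≡.sym (ℕ.∸-+-assoc (m i) (b i) (c i)))))))) ⟩
    sumBelow m (λ b → sumBelow (m ∸ᵐ b) (λ c → P b * (Q c * S (m ∸ᵐ b ∸ᵐ c))))
      ≈⟨ sumBelow-cong m (λ b → *-distribˡ-sumBelow (m ∸ᵐ b) (P b) _) ⟨
    sumBelow m (λ b → P b * sumBelow (m ∸ᵐ b) (λ c → Q c * S (m ∸ᵐ b ∸ᵐ c))) ∎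

  constP-*ₚ : ∀ {r} x {P : Series r} → Extensional P → (constP x *ₚ P) ≈ₚ (λ m → x * P m)
  constP-*ₚ {r} x {P} extP m = trans
    (sumBelow-single m (λ _ → 0) {λ a → constP x a * P (m ∸ᵐ a)} (λ _ → ℕ.z≤n)
      (λ a≗ → *-cong (constP-extensional x a≗) (extP (λ i → ≡.cong (m i ∸_) (a≗ i))))
      (λ a _ (i , aᵢ≢0) → trans (*-congʳ (constP-off-0 x a i aᵢ≢0)) (zeroˡ _)))
    (*-congʳ (constP-at-0 {r} x))

  *ₚ-identityˡ : ∀ {r} {P : Series r} → Extensional P → (1ₚ *ₚ P) ≈ₚ P
  *ₚ-identityˡ extP m = trans (constP-*ₚ 1# extP m) (*-identityˡ _)

  *ₚ-identityʳ : ∀ {r} {P : Series r} → Extensional P → (P *ₚ 1ₚ) ≈ₚ P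
  *ₚ-identityʳ extP m = trans (*ₚ-comm extP (constP-extensional 1#) m) (*ₚ-identityˡ extP m)

  *ₚ-distribˡ : ∀ {r} (P Q S : Series r) → (P *ₚ (Q +ₚ S)) ≈ₚ ((P *ₚ Q) +ₚ (P *ₚ S))
  *ₚ-distribˡ P Q S m = trans (sumBelow-cong m (λ a → distribˡ _ _ _)) (sumBelow-+ m _ _)

  *ₚ-distribʳ : ∀ {r} (P Q S : Series r) → ((Q +ₚ S) *ₚ P) ≈ₚ ((Q *ₚ P) +ₚ (S *ₚ P))
  *ₚ-distribʳ P Q S m = trans (sumBelow-cong m (λ a → distribʳ _ _ _)) (sumBelow-+ m _ _)

  isPoly-+ : ∀ {r} {P Q : Series r} → IsPoly P → IsPoly Q → IsPoly (P +ₚ Q)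
  isPoly-+ (d , P≈0) (d′ , Q≈0) = d ℕ.⊔ d′ , λ m i d⊔d′<mᵢ →
    trans (+-cong (P≈0 m i (ℕ.≤-<-trans (ℕ.m≤m⊔n d d′) d⊔d′<mᵢ)) (Q≈0 m i (ℕ.≤-<-trans (ℕ.m≤n⊔m d d′) d⊔d′<mᵢ)))
          (+-identityˡ 0#)

  isPoly-neg : ∀ {r} {P : Series r} → IsPoly P → IsPoly (-ₚ P)
  isPoly-neg (d , P≈0) = d , λ m i d<mᵢ → trans (-‿cong (P≈0 m i d<mᵢ)) ε⁻¹≈ε

  isPoly-constP : ∀ {r} x → IsPoly {r} (constP x)
  isPoly-constP x = 0 , λ m i 0<mᵢ → constP-off-0 x m i (ℕ.>⇒≢ 0<mᵢ)

  -- a coefficient of degree > d + d′ in some variable forces a factor of degree > d or > d′ there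
  isPoly-* : ∀ {r} {P Q : Series r} → IsPoly P → IsPoly Q → IsPoly (P *ₚ Q)
  isPoly-* {P = P} {Q} (d , P≈0) (d′ , Q≈0) = d ℕ.+ d′ , λ m i d+d′<mᵢ → sumBelow-zero m (λ a _ → term m i d+d′<mᵢ a)
    where
    term : ∀ m i → d ℕ.+ d′ < m i → ∀ a → P a * Q (m ∸ᵐ a) ≈ 0#
    term m i d+d′<mᵢ a with a i ℕ.≤? d
    ... | no aᵢ≰d = trans (*-congʳ (P≈0 a i (ℕ.≰⇒> aᵢ≰d))) (zeroˡ _)
    ... | yes aᵢ≤d = trans (*-congˡ (Q≈0 (m ∸ᵐ a) i (ℕ.m+n≤o⇒m≤o∸n (suc d′) (ℕ.≤-trans
            (s≤s (ℕ.≤-trans (ℕ.+-monoʳ-≤ d′ aᵢ≤d) (ℕ.≤-reflexive (ℕ.+-comm d′ d)))) d+d′<mᵢ)))) (zeroʳ _)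

  IsPolynomial : ∀ {r} → Series r → Set ℓ
  IsPolynomial P = Extensional P × IsPoly P

  constP-0 : ∀ {r} → constP {r} 0# ≈ₚ 0ₚ
  constP-0 {zero}  m = refl
  constP-0 {suc r} m with m zero
  ... | zero  = constP-0 (tl m)
  ... | suc _ = refl

  constP-+ : ∀ {r} x y → constP {r} (x + y) ≈ₚ (constP x +ₚ constP y)
  constP-+ {zero}  x y m = refl
  constP-+ {suc r} x y m with m zero
  ... | zero  = constP-+ x y (tl m)
  ... | suc _ = sym (+-identityˡ 0#)

  constP-scale : ∀ {r} x y → constP {r} (x * y) ≈ₚ (λ m → x * constP y m)
  constP-scale {zero}  x y m = refl
  constP-scale {suc r} x y m with m zero
  ... | zero  = constP-scale x y (tl m)
  ... | suc _ = sym (zeroʳ x)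

  constP-sumLT : ∀ {r} N (h : ℕ → K) → constP {r} (sumLT N h) ≈ₚ sumLTₚ N (constP ∘ h)
  constP-sumLT zero    h m = constP-0 m
  constP-sumLT (suc N) h m = trans (constP-+ _ _ m) (+-congʳ (constP-sumLT N h m))

  single-extensional : ∀ {r} (p : Fin r) (g : ℕ → K) → Extensional (single p g)
  single-extensional {suc r} zero g {m} {m′} m≗m′ rewrite m≗m′ zero = constP-extensional _ (m≗m′ ∘ suc)
  single-extensional {suc r} (suc p) g {m} {m′} m≗m′ with m zero | m′ zero | m≗m′ zero
  ... | zero  | zero  | _ = single-extensional p g (m≗m′ ∘ suc)
  ... | suc _ | suc _ | _ = refl

  single-cong : ∀ {r} (p : Fin r) {g h : ℕ → K} → (∀ e → g e ≈ h e) → single p g ≈ₚ single p h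
  single-cong {suc r} zero g≈h m = constP-cong (g≈h (m zero)) (tl m)
  single-cong {suc r} (suc p) g≈h m with m zero
  ... | zero  = single-cong p g≈h (tl m)
  ... | suc _ = refl

  single-+ : ∀ {r} (p : Fin r) (g h : ℕ → K) → single p (λ e → g e + h e) ≈ₚ (single p g +ₚ single p h)
  single-+ {suc r} zero g h m = constP-+ _ _ (tl m)
  single-+ {suc r} (suc p) g h m with m zero
  ... | zero  = single-+ p g h (tl m)
  ... | suc _ = sym (+-identityˡ 0#)

  single-scale : ∀ {r} (p : Fin r) x (g : ℕ → K) → single p (λ e → x * g e) ≈ₚ (λ m → x * single p g m)
  single-scale {suc r} zero x g m = constP-scale _ _ (tl m)
  single-scale {suc r} (suc p) x g m with m zero
  ... | zero  = single-scale p x g (tl m)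
  ... | suc _ = sym (zeroʳ x)

  single-neg : ∀ {r} (p : Fin r) (g : ℕ → K) → single p (λ e → - g e) ≈ₚ (-ₚ single p g)
  single-neg p g m = trans (single-cong p (λ e → sym (-1*x≈-x (g e))) m) (trans (single-scale p (- 1#) g m) (-1*x≈-x _))

  constant : K → ℕ → K
  constant x zero    = x
  constant x (suc _) = 0#

  single-const : ∀ {r} (p : Fin r) {g : ℕ → K} → (∀ e → g (suc e) ≈ 0#) → single p g ≈ₚ constP (g 0)
  single-const {suc r} zero {g} g≈0 m with m zero
  ... | zero  = refl
  ... | suc e = trans (constP-cong (g≈0 e) (tl m)) (constP-0 (tl m))
  single-const {suc r} (suc p) g≈0 m with m zero
  ... | zero  = single-const p g≈0 (tl m)
  ... | suc _ = refl

  single-sumLT : ∀ {r} (p : Fin r) N (h : ℕ → ℕ → K) →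
    single p (λ e → sumLT N (λ j → h j e)) ≈ₚ sumLTₚ N (λ j → single p (h j))
  single-sumLT p zero    h m = trans (single-const p (λ _ → refl) m) (constP-0 m)
  single-sumLT p (suc N) h m = trans (single-+ p _ _ m) (+-congʳ (single-sumLT p N h m))

  single-sub-constant : ∀ {r} (p : Fin r) h x → single p (λ e → h e - constant x e) ≈ₚ (single p h +ₚ (-ₚ constP x))
  single-sub-constant p h x m = trans (single-+ p h (λ e → - constant x e) m)
    (+-congˡ (trans (single-neg p (constant x) m) (-‿cong (single-const p (λ _ → refl) m))))

  isPoly-single : ∀ {r} (p : Fin r) {g : ℕ → K} d → (∀ e → d < e → g e ≈ 0#) → IsPoly (single p g)
  isPoly-single p {g} d g≈0 = d , vanish p
    where
    vanish : ∀ {r} (p : Fin r) (m : Mon r) i → d < m i → single p g m ≈ 0#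
    vanish {suc r} zero    m zero    d<m₀ = trans (constP-cong (g≈0 _ d<m₀) (tl m)) (constP-0 (tl m))
    vanish {suc r} zero    m (suc i) d<mᵢ = constP-off-0 _ (tl m) i (ℕ.>⇒≢ (ℕ.≤-<-trans ℕ.z≤n d<mᵢ))
    vanish {suc r} (suc p) m zero d<m₀ with m zero
    ... | zero  = contradiction d<m₀ ℕ.n≮0
    ... | suc _ = refl
    vanish {suc r} (suc p) m (suc i) d<mᵢ with m zero
    ... | zero  = vanish p (tl m) i d<mᵢ
    ... | suc _ = refl

  conv : (ℕ → K) → (ℕ → K) → ℕ → K
  conv g h e = sumLT (suc e) (λ i → g i * h (e ∸ i))

  constP-*ₚ-constP : ∀ {r} x y → (constP {r} x *ₚ constP y) ≈ₚ constP (x * y)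
  constP-*ₚ-constP x y m = trans (constP-*ₚ x (constP-extensional y) m) (sym (constP-scale x y m))

  single-*ₚ-single : ∀ {r} (p : Fin r) (g h : ℕ → K) → (single p g *ₚ single p h) ≈ₚ single p (conv g h)
  single-*ₚ-single {suc r} zero g h m = trans
    (sumLT-cong (suc (m zero)) (λ k → constP-*ₚ-constP (g k) (h (m zero ∸ k)) (tl m)))
    (sym (constP-sumLT (suc (m zero)) (λ i → g i * h (m zero ∸ i)) (tl m)))
  single-*ₚ-single {suc r} (suc p) g h m with m zero
  ... | zero  = trans (+-identityˡ _) (single-*ₚ-single p g h (tl m))
  ... | suc k = sumLT-zero (suc (suc k)) λ
    { zero    _ → sumBelow-zero (tl m) (λ _ _ → zeroʳ _)
    ; (suc j) _ → sumBelow-zero (tl m) (λ _ _ → zeroˡ _) }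

  -- multiplication by t
  shift : (ℕ → K) → ℕ → K
  shift g zero    = 0#
  shift g (suc e) = g e

  tpow-≡ : ∀ k e → e ≡ k → tpow k e ≈ 1#
  tpow-≡ k e e≡k with e ℕ.≟ k
  ... | yes _   = refl
  ... | no e≢k = contradiction e≡k e≢k

  tpow-≢ : ∀ k e → e ≢ k → tpow k e ≈ 0#
  tpow-≢ k e e≢k with e ℕ.≟ k
  ... | yes e≡k = contradiction e≡k e≢k
  ... | no _    = refl

  conv-tpow-1 : ∀ g e → conv g (tpow 1) e ≈ shift g e
  conv-tpow-1 g zero    = trans (+-identityˡ _) (trans (*-congˡ (tpow-≢ 1 0 (λ ()))) (zeroʳ _))
  conv-tpow-1 g (suc e) = trans (sumLT-single (suc (suc e)) e (ℕ.m<n⇒m<1+n ℕ.≤-refl) off-e)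
                                (trans (*-congˡ (tpow-≡ 1 (suc e ∸ e) (ℕ.m+n∸n≡m 1 e))) (*-identityʳ _))
    where
    off-e : ∀ i → i < suc (suc e) → i ≢ e → g i * tpow 1 (suc e ∸ i) ≈ 0#
    off-e i i≤1+e i≢e = trans (*-congˡ (tpow-≢ 1 (suc e ∸ i) λ 1+e∸i≡1 → i≢e (ℕ.suc-injective (≡.sym (≡.trans
      (≡.sym (ℕ.m∸n+n≡m (ℕ.≤-pred i≤1+e))) (≡.cong (ℕ._+ i) 1+e∸i≡1)))))) (zeroʳ _)

  shift-tpow : ∀ k e → shift (tpow k) e ≈ tpow (suc k) e
  shift-tpow k zero = sym (tpow-≢ (suc k) 0 (λ ()))
  shift-tpow k (suc e) with e ℕ.≟ k
  ... | yes e≡k = sym (tpow-≡ (suc k) (suc e) (≡.cong suc e≡k))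
  ... | no e≢k  = sym (tpow-≢ (suc k) (suc e) (e≢k ∘ ℕ.suc-injective))

  tpow-expansion : ∀ (g : ℕ → K) N → (∀ e → N ≤ e → g e ≈ 0#) → ∀ e → g e ≈ sumLT N (λ j → g j * tpow j e)
  tpow-expansion g N g≈0 e with e ℕ.<? N
  ... | yes e<N = sym (trans
        (sumLT-single N e e<N (λ j _ j≢e → trans (*-congˡ (tpow-≢ j e (j≢e ∘ ≡.sym))) (zeroʳ _)))
        (trans (*-congˡ (tpow-≡ e e ≡.refl)) (*-identityʳ _)))
  ... | no e≮N = trans (g≈0 e (ℕ.≮⇒≥ e≮N))
        (sym (sumLT-zero N (λ j j<N → trans (*-congˡ (tpow-≢ j e (λ e≡j → e≮N (≡.subst (_< N) (≡.sym e≡j) j<N)))) (zeroʳ _))))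

  single-expansion : ∀ {r} (p : Fin r) g N → (∀ e → N ≤ e → g e ≈ 0#) →
    single p g ≈ₚ sumLTₚ N (λ j → constP (g j) *ₚ single p (tpow j))
  single-expansion p g N g≈0 m = begin
    single p g m                                         ≈⟨ single-cong p (tpow-expansion g N g≈0) m ⟩
    single p (λ e → sumLT N (λ j → g j * tpow j e)) m    ≈⟨ single-sumLT p N (λ j e → g j * tpow j e) m ⟩
    sumLT N (λ j → single p (λ e → g j * tpow j e) m)    ≈⟨ sumLT-cong N (λ j → single-scale p (g j) (tpow j) m) ⟩
    sumLT N (λ j → g j * single p (tpow j) m)            ≈⟨ sumLT-cong N (λ j → constP-*ₚ (g j) (single-extensional p (tpow j)) m) ⟨
    sumLT N (λ j → (constP (g j) *ₚ single p (tpow j)) m) ∎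

  Vanishes : ℕ → (ℕ → K) → Set ℓ
  Vanishes d g = ∀ e → d < e → g e ≈ 0#

  tpow-vanishes : ∀ k → Vanishes k (tpow k)
  tpow-vanishes k e k<e = tpow-≢ k e (ℕ.>⇒≢ k<e)

  shift-vanishes : ∀ {d g} → Vanishes d g → Vanishes (suc d) (shift g)
  shift-vanishes g≈0 (suc e) (s≤s d<e) = g≈0 e d<e

  constant-vanishes : ∀ x → Vanishes 0 (constant x)
  constant-vanishes x (suc e) _ = refl

module PolynomialRing {c ℓ} (R : CommutativeRing c ℓ) (r : ℕ) where
  private module K = CommutativeRing R
  open Poly R using (Series; single; constP; tpow; sumLTₚ; sumFin; CongMod; _≈ₚ_; _*ₚ_; 1ₚ)
  open SeriesAlgebra R

  Polynomial : Set (c ⊔ ℓ)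
  Polynomial = Σ (Series r) IsPolynomial

  infix 4 _≈ᴾ_
  record _≈ᴾ_ (P Q : Polynomial) : Set (c ⊔ ℓ) where
    constructor coefficientwise
    field coeff-≈ : proj₁ P ≈ₚ proj₁ Q
  open _≈ᴾ_ public

  infixl 6 _+ᴾ_
  infixl 7 _*ᴾ_
  -- opaque, so that unification sees the ring operations rather than their coefficients
  opaque
    _+ᴾ_ : Polynomial → Polynomial → Polynomial
    (P , extP , polyP) +ᴾ (Q , extQ , polyQ) = P +ₚ Q , (λ m≗ → K.+-cong (extP m≗) (extQ m≗)) , isPoly-+ polyP polyQ

    _*ᴾ_ : Polynomial → Polynomial → Polynomial
    (P , extP , polyP) *ᴾ (Q , extQ , polyQ) = P *ₚ Q , *ₚ-extensional extP extQ , isPoly-* polyP polyQ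

    -ᴾ_ : Polynomial → Polynomial
    -ᴾ (P , extP , polyP) = -ₚ P , K.-‿cong ∘ extP , isPoly-neg polyP

  0ᴾ 1ᴾ : Polynomial
  0ᴾ = 0ₚ , (λ _ → K.refl) , (0 , λ _ _ _ → K.refl)
  1ᴾ = 1ₚ , constP-extensional K.1# , isPoly-constP K.1#

  opaque
    unfolding _+ᴾ_ _*ᴾ_ -ᴾ_

    coeff-+ᴾ : ∀ P Q → proj₁ (P +ᴾ Q) ≈ₚ (proj₁ P +ₚ proj₁ Q)
    coeff-+ᴾ P Q m = K.refl

    coeff-*ᴾ : ∀ P Q → proj₁ (P *ᴾ Q) ≈ₚ (proj₁ P *ₚ proj₁ Q)
    coeff-*ᴾ P Q m = K.refl

    coeff--ᴾ : ∀ P → proj₁ (-ᴾ P) ≈ₚ (-ₚ proj₁ P)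
    coeff--ᴾ P m = K.refl

    polynomial-isCommutativeRing : IsCommutativeRing _≈ᴾ_ _+ᴾ_ _*ᴾ_ -ᴾ_ 0ᴾ 1ᴾ
    polynomial-isCommutativeRing = record
      { isRing = record
        { +-isAbelianGroup = record
          { isGroup = record
            { isMonoid = record
              { isSemigroup = record
                { isMagma = record
                  { isEquivalence = record
                    { refl = coefficientwise (λ _ → K.refl)
                    ; sym = λ (coefficientwise P≈Q) → coefficientwise (λ m → K.sym (P≈Q m))
                    ; trans = λ (coefficientwise P≈Q) (coefficientwise Q≈S) → coefficientwise (λ m → K.trans (P≈Q m) (Q≈S m)) }
                  ; ∙-cong = λ (coefficientwise P≈P′) (coefficientwise Q≈Q′) →
                      coefficientwise (λ m → K.+-cong (P≈P′ m) (Q≈Q′ m)) }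
                ; assoc = λ _ _ _ → coefficientwise (λ _ → K.+-assoc _ _ _) }
              ; identity = (λ _ → coefficientwise (λ _ → K.+-identityˡ _)) , (λ _ → coefficientwise (λ _ → K.+-identityʳ _)) }
            ; inverse = (λ _ → coefficientwise (λ _ → K.-‿inverseˡ _)) , (λ _ → coefficientwise (λ _ → K.-‿inverseʳ _))
            ; ⁻¹-cong = λ (coefficientwise P≈Q) → coefficientwise (λ m → K.-‿cong (P≈Q m)) }
          ; comm = λ _ _ → coefficientwise (λ _ → K.+-comm _ _) }
        ; *-cong = λ (coefficientwise P≈P′) (coefficientwise Q≈Q′) → coefficientwise (*ₚ-cong P≈P′ Q≈Q′)
        ; *-assoc = λ (P , extP , _) (Q , extQ , _) (S , extS , _) → coefficientwise (*ₚ-assoc extP extQ extS)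
        ; *-identity = (λ (P , extP , _) → coefficientwise (*ₚ-identityˡ extP))
                     , (λ (P , extP , _) → coefficientwise (*ₚ-identityʳ extP))
        ; distrib = (λ (P , _) (Q , _) (S , _) → coefficientwise (*ₚ-distribˡ P Q S))
                  , (λ (P , _) (Q , _) (S , _) → coefficientwise (*ₚ-distribʳ P Q S)) }
      ; *-comm = λ (P , extP , _) (Q , extQ , _) → coefficientwise (*ₚ-comm extP extQ) }

  polynomialRing : CommutativeRing (c ⊔ ℓ) (c ⊔ ℓ)
  polynomialRing = record { isCommutativeRing = polynomial-isCommutativeRing }

  open CommutativeRing polynomialRing hiding (zero)
  open import Algebra.Properties.Semiring.Exp semiring using (_^_)
  open import Algebra.Properties.Semiring.Sum semiring using (sum; sum-syntax; sum-cong-≋; sum-init-last)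
  open import Relation.Binary.Reasoning.Setoid setoid

  κ : K.Carrier → Carrier
  κ x = constP x , constP-extensional x , isPoly-constP x

  univariate : (p : Fin r) (g : ℕ → K.Carrier) (d : ℕ) → Vanishes d g → Carrier
  univariate p g d g≈0 = single p g , single-extensional p g , isPoly-single p d g≈0

  𝕏 : Fin r → Carrier
  𝕏 p = univariate p (tpow 1) 1 (tpow-vanishes 1)

  sumLTₚ≈∑ : ∀ N (F : ℕ → Carrier) → sumLTₚ N (proj₁ ∘ F) ≈ₚ proj₁ (∑[ j < N ] F (toℕ j))
  sumLTₚ≈∑ zero    F m = K.refl
  sumLTₚ≈∑ (suc N) F m = K.trans (K.+-congʳ (sumLTₚ≈∑ N F m)) (K.sym (K.trans (coeff-≈ (sum-init-last (F ∘ toℕ)) m)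
    (K.trans (coeff-+ᴾ _ _ m) (K.+-cong
      (coeff-≈ (sum-cong-≋ {N} (λ j → reflexive (≡.cong F (toℕ-inject₁ j)))) m)
      (coeff-≈ (reflexive (≡.cong F (toℕ-fromℕ N))) m)))))

  univariate-cong : ∀ p {g h d d′} (g≈0 : Vanishes d g) (h≈0 : Vanishes d′ h) →
    (∀ e → g e K.≈ h e) → univariate p g d g≈0 ≈ univariate p h d′ h≈0
  univariate-cong p _ _ g≈h = coefficientwise (single-cong p g≈h)

  univariate-constant : ∀ p x → univariate p (constant x) 0 (constant-vanishes x) ≈ κ x
  univariate-constant p x = coefficientwise (single-const p (λ _ → K.refl))

  univariate-*-𝕏 : ∀ p {g d} (g≈0 : Vanishes d g) →
    univariate p g d g≈0 * 𝕏 p ≈ univariate p (shift g) (suc d) (shift-vanishes g≈0)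
  univariate-*-𝕏 p {g} _ = coefficientwise (λ m →
    K.trans (coeff-*ᴾ _ _ m) (K.trans (single-*ₚ-single p g (tpow 1) m) (single-cong p (conv-tpow-1 g) m)))

  monomial : Fin r → ℕ → Carrier
  monomial p k = univariate p (tpow k) k (tpow-vanishes k)

  monomial≈𝕏^ : ∀ p k → monomial p k ≈ 𝕏 p ^ k
  monomial≈𝕏^ p zero = trans (univariate-cong p (tpow-vanishes 0) (constant-vanishes K.1#) tpow-0) (univariate-constant p K.1#)
    where
    tpow-0 : ∀ e → tpow 0 e K.≈ constant K.1# e
    tpow-0 zero    = tpow-≡ 0 0 ≡.refl
    tpow-0 (suc e) = tpow-≢ 0 (suc e) (λ ())
  monomial≈𝕏^ p (suc k) = begin
    univariate p (tpow (suc k)) (suc k) (tpow-vanishes (suc k))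
      ≈⟨ univariate-cong p (tpow-vanishes (suc k)) (shift-vanishes (tpow-vanishes k)) (λ e → K.sym (shift-tpow k e)) ⟩
    univariate p (shift (tpow k)) (suc k) (shift-vanishes (tpow-vanishes k))
      ≈⟨ univariate-*-𝕏 p (tpow-vanishes k) ⟨
    univariate p (tpow k) k (tpow-vanishes k) * 𝕏 p
      ≈⟨ *-comm _ _ ⟩
    𝕏 p * univariate p (tpow k) k (tpow-vanishes k)
      ≈⟨ *-congˡ (monomial≈𝕏^ p k) ⟩
    𝕏 p * 𝕏 p ^ k ∎

  univariate-expansion : ∀ p {g d} (g≈0 : Vanishes d g) N → (∀ e → N ≤ e → g e K.≈ K.0#) →
    univariate p g d g≈0 ≈ ∑[ j < N ] (κ (g (toℕ j)) * 𝕏 p ^ toℕ j)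
  univariate-expansion p {g} g≈0 N g≈0′ = trans expand (sum-cong-≋ {N} (λ j → *-congˡ (monomial≈𝕏^ p (toℕ j))))
    where
    expand : univariate p g _ g≈0 ≈ ∑[ j < N ] (κ (g (toℕ j)) * monomial p (toℕ j))
    expand = coefficientwise (λ m → K.trans (single-expansion p g N g≈0′ m) (K.trans
      (sumLT-cong N (λ j → K.sym (coeff-*ᴾ (κ (g j)) (monomial p j) m))) (sumLTₚ≈∑ N (λ j → κ (g j) * monomial p j) m)))

  coeff-− : ∀ P Q → proj₁ (P - Q) ≈ₚ (λ m → proj₁ P m K.- proj₁ Q m)
  coeff-− P Q m = K.trans (coeff-+ᴾ P (- Q) m) (K.+-congˡ (coeff--ᴾ Q m))

  coeff-∑ : ∀ {k} (v : Fin k → Carrier) → proj₁ (sum v) ≈ₚ (λ m → sumFin (λ i → proj₁ (v i) m))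
  coeff-∑ {zero}  v m = K.refl
  coeff-∑ {suc k} v m = K.trans (coeff-+ᴾ (v zero) (sum (v ∘ suc)) m) (K.+-congˡ (coeff-∑ (v ∘ suc) m))

  ∼⇒CongMod : ∀ {g} (gens : Fin g → Carrier) {P Q} → IdealQuotient._∼_ polynomialRing gens P Q →
    CongMod (proj₁ ∘ gens) (proj₁ P) (proj₁ Q)
  ∼⇒CongMod gens {P} {Q} (h , P-Q≈∑) = proj₁ ∘ h , proj₂ ∘ proj₂ ∘ h , λ m →
    K.trans (K.sym (coeff-− P Q m)) (K.trans (coeff-≈ P-Q≈∑ m)
      (K.trans (coeff-∑ (λ i → gens i * h i) m) (sumFin-cong (λ i → coeff-*ᴾ (gens i) (h i) m))))

module WeilCoefficients {c ℓ} (R : CommutativeRing c ℓ) (n : ℕ) (a : Fin n → CommutativeRing.Carrier R) where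
  open CommutativeRing R renaming (Carrier to K) hiding (zero)
  open Poly.WithF R n a using (fcoef; Dmono)
  open SeriesAlgebra R using (Vanishes; shift; constant)
  open import Algebra.Properties.Group +-group using (ε⁻¹≈ε)
  open import Relation.Binary.Reasoning.Setoid setoid

  fcoef-vanishes : Vanishes n fcoef
  fcoef-vanishes k n<k with k ℕ.<? n
  ... | yes k<n = contradiction k<n (ℕ.<-asym n<k)
  ... | no _ with k ℕ.≟ n
  ...   | yes k≡n = contradiction (≡.sym k≡n) (ℕ.<⇒≢ n<k)
  ...   | no _    = refl

  fcoef-monic : fcoef n ≈ 1#
  fcoef-monic with n ℕ.<? n
  ... | yes n<n = contradiction n<n (ℕ.<-irrefl ≡.refl)
  ... | no _ with n ℕ.≟ n
  ...   | yes _   = refl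
  ...   | no n≢n = contradiction ≡.refl n≢n

  -- the Horner polynomial f_k(t) = a_k + a_{k+1} t + ⋯ + a_n t^{n-k}
  horner : ℕ → ℕ → K
  horner k e = fcoef (k ℕ.+ e)

  horner-vanishes : ∀ k → Vanishes n (horner k)
  horner-vanishes k e n<e = fcoef-vanishes (k ℕ.+ e) (ℕ.<-≤-trans n<e (ℕ.m≤n+m e k))

  Dmono≈horner : ∀ k e → Dmono k e ≈ horner (suc k) e
  Dmono≈horner k e with e ℕ.<? n ∸ k
  ... | yes _ = reflexive (≡.cong fcoef (ℕ.+-comm (k ℕ.+ e) 1))
  ... | no e≮n∸k = sym (fcoef-vanishes (suc k ℕ.+ e) (ℕ.≰⇒> λ 1+k+e≤n →
        e≮n∸k (ℕ.m+n≤o⇒m≤o∸n (suc e) (≡.subst (ℕ._≤ n) (≡.cong suc (ℕ.+-comm k e)) 1+k+e≤n))))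

  Dmono-sym : ∀ k j → Dmono k j ≈ Dmono j k
  Dmono-sym k j = trans (Dmono≈horner k j) (trans (reflexive (≡.cong (fcoef ∘ suc) (ℕ.+-comm k j))) (sym (Dmono≈horner j k)))

  Dmono-vanishes : ∀ k → Vanishes n (Dmono k)
  Dmono-vanishes k e n<e = trans (Dmono≈horner k e) (horner-vanishes (suc k) e n<e)

  Dmono-degree< : ∀ k e → n ≤ e → Dmono k e ≈ 0#
  Dmono-degree< k e n≤e = trans (Dmono≈horner k e) (fcoef-vanishes _ (s≤s (ℕ.≤-trans n≤e (ℕ.m≤n+m e k))))

  -- f_k(t) = a_k + t D_f(t^k)
  shift-Dmono : ∀ k e → shift (Dmono k) e ≈ horner k e - constant (fcoef k) e
  shift-Dmono k zero    = sym (trans (+-congʳ (reflexive (≡.cong fcoef (ℕ.+-identityʳ k)))) (-‿inverseʳ _))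
  shift-Dmono k (suc e) = begin
    Dmono k e                 ≈⟨ Dmono≈horner k e ⟩
    fcoef (suc k ℕ.+ e)       ≡⟨ ≡.cong fcoef (ℕ.+-suc k e) ⟨
    horner k (suc e)          ≈⟨ +-identityʳ _ ⟨
    horner k (suc e) + 0#     ≈⟨ +-congˡ ε⁻¹≈ε ⟨
    horner k (suc e) - 0#     ∎

  horner-last : ∀ e → horner n e ≈ constant 1# e
  horner-last zero    = trans (reflexive (≡.cong fcoef (ℕ.+-identityʳ n))) fcoef-monic
  horner-last (suc e) = fcoef-vanishes (n ℕ.+ suc e) (ℕ.m<m+n n (s≤s ℕ.z≤n))

module WeilPolynomials {c ℓ} (R : CommutativeRing c ℓ) (n : ℕ) (a : Fin n → CommutativeRing.Carrier R) (r : ℕ) where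
  private module K = CommutativeRing R
  open Poly R using (_≈ₚ_)
  open Poly.WithF R n a using (fcoef; Dmono; O2)
  open SeriesAlgebra R
  open WeilCoefficients R n a
  open PolynomialRing R r
  open CommutativeRing polynomialRing hiding (zero)
  open CommutativeRingLemmas polynomialRing
  open import Algebra.Properties.Semiring.Exp semiring using (_^_)
  open import Algebra.Properties.Semiring.Sum semiring
    using (sum; sum-syntax; sum-cong-≋; sum-init-last; *-distribʳ-sum; ∑-comm)
  open import Algebra.Properties.CommutativeSemigroup *-commutativeSemigroup using (xy∙z≈xz∙y)
  open import Algebra.Properties.CommutativeSemigroup +-commutativeSemigroup using () renaming (xy∙z≈xz∙y to xy+z≈xz+y)
  open import Algebra.Properties.AbelianGroup +-abelianGroup using (⁻¹-∙-comm)
  open import Algebra.Properties.Ring ring using ([y-z]x≈yx-zx)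
  open import Relation.Binary.Reasoning.Setoid setoid

  D : Fin r → ℕ → Carrier
  D p k = univariate p (Dmono k) n (Dmono-vanishes k)

  Horner : Fin r → ℕ → Carrier
  Horner p k = univariate p (horner k) n (horner-vanishes k)

  f : Fin r → Carrier
  f p = univariate p fcoef n fcoef-vanishes

  W : Fin r → Fin r → Carrier
  W p q = ∑[ k < n ] (D p (toℕ k) * 𝕏 q ^ toℕ k)

  W-coeff : ∀ p q → proj₁ (W p q) ≈ₚ O2 p q
  W-coeff p q m = K.sym (K.trans
    (sumLT-cong n (λ k → K.sym (coeff-*ᴾ (D p k) (monomial q k) m)))
    (K.trans (sumLTₚ≈∑ n (λ k → D p k * monomial q k) m)
             (coeff-≈ (sum-cong-≋ {n} (λ k → *-congˡ (monomial≈𝕏^ q (toℕ k)))) m)))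

  D≈Horner : ∀ p k → D p k ≈ Horner p (suc k)
  D≈Horner p k = univariate-cong p (Dmono-vanishes k) (horner-vanishes (suc k)) (Dmono≈horner k)

  D*𝕏 : ∀ p k → D p k * 𝕏 p ≈ Horner p k - κ (fcoef k)
  D*𝕏 p k = coefficientwise (λ m →
    K.trans (coeff-≈ (univariate-*-𝕏 p (Dmono-vanishes k)) m) (K.trans (single-cong p (shift-Dmono k) m)
    (K.trans (single-sub-constant p (horner k) (fcoef k) m) (K.sym (K.trans (coeff-+ᴾ _ _ m) (K.+-congˡ (coeff--ᴾ _ m)))))))

  Horner-0 : ∀ p → Horner p 0 ≈ f p
  Horner-0 p = coefficientwise (λ _ → K.refl)

  Horner-n : ∀ p → Horner p n ≈ 1#
  Horner-n p = trans (univariate-cong p (horner-vanishes n) (constant-vanishes K.1#) horner-last) (univariate-constant p K.1#)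

  f-expansion : ∀ q → f q ≈ ∑[ k < n ] (κ (fcoef (toℕ k)) * 𝕏 q ^ toℕ k) + 𝕏 q ^ n
  f-expansion q = begin
    f q
      ≈⟨ univariate-expansion q fcoef-vanishes (suc n) fcoef-vanishes ⟩
    ∑[ k < suc n ] term (toℕ k)
      ≈⟨ sum-init-last (term ∘ toℕ) ⟩
    ∑[ k < n ] term (toℕ (inject₁ k)) + term (toℕ (fromℕ n))
      ≈⟨ +-cong (sum-cong-≋ {n} (λ k → reflexive (≡.cong term (toℕ-inject₁ k)))) (reflexive (≡.cong term (toℕ-fromℕ n))) ⟩
    ∑[ k < n ] term (toℕ k) + κ (fcoef n) * 𝕏 q ^ n
      ≈⟨ +-congˡ (trans (*-congʳ (coefficientwise (constP-cong fcoef-monic))) (*-identityˡ _)) ⟩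
    ∑[ k < n ] term (toℕ k) + 𝕏 q ^ n ∎
    where
    term : ℕ → Carrier
    term k = κ (fcoef k) * 𝕏 q ^ k

  -- telescoping along the Horner scheme f_k(X_p) = a_k + X_p D_f(X_p^k)
  W-difference : ∀ p q → W p q * 𝕏 p - W p q * 𝕏 q ≈ f p - f q
  W-difference p q = begin
    W p q * 𝕏 p - W p q * 𝕏 q
      ≈⟨ +-cong (trans (*-distribʳ-sum (𝕏 p) term) (sum-cong-≋ {n} (by-𝕏p ∘ toℕ)))
                (-‿cong (trans (*-distribʳ-sum (𝕏 q) term) (sum-cong-≋ {n} (by-𝕏q ∘ toℕ)))) ⟩
    ∑[ k < n ] (T (toℕ k) - C (toℕ k)) - ∑[ k < n ] T (suc (toℕ k))
      ≈⟨ ∑-distrib-− {n} (λ k → T (toℕ k) - C (toℕ k)) (λ k → T (suc (toℕ k))) ⟨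
    ∑[ k < n ] ((T (toℕ k) - C (toℕ k)) - T (suc (toℕ k)))
      ≈⟨ sum-cong-≋ {n} (λ k → xy+z≈xz+y (T (toℕ k)) (- C (toℕ k)) (- T (suc (toℕ k)))) ⟩
    ∑[ k < n ] ((T (toℕ k) - T (suc (toℕ k))) - C (toℕ k))
      ≈⟨ ∑-distrib-− {n} (λ k → T (toℕ k) - T (suc (toℕ k))) (C ∘ toℕ) ⟩
    ∑[ k < n ] (T (toℕ k) - T (suc (toℕ k))) - ∑[ k < n ] C (toℕ k)
      ≈⟨ +-congʳ (∑-telescope n T) ⟩
    (T 0 - T n) - ∑[ k < n ] C (toℕ k)
      ≈⟨ +-congʳ (+-cong (trans (*-identityʳ _) (Horner-0 p)) (-‿cong (trans (*-congʳ (Horner-n p)) (*-identityˡ _)))) ⟩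
    (f p - 𝕏 q ^ n) - ∑[ k < n ] C (toℕ k)
      ≈⟨ trans (+-assoc _ _ _) (+-congˡ (trans (+-comm _ _) (⁻¹-∙-comm _ _))) ⟩
    f p - (∑[ k < n ] C (toℕ k) + 𝕏 q ^ n)
      ≈⟨ +-congˡ (-‿cong (f-expansion q)) ⟨
    f p - f q ∎
    where
    term : Fin n → Carrier
    term k = D p (toℕ k) * 𝕏 q ^ toℕ k
    T C : ℕ → Carrier
    T k = Horner p k * 𝕏 q ^ k
    C k = κ (fcoef k) * 𝕏 q ^ k
    by-𝕏p : ∀ k → (D p k * 𝕏 q ^ k) * 𝕏 p ≈ T k - C k
    by-𝕏p k = trans (xy∙z≈xz∙y (D p k) _ _) (trans (*-congʳ (D*𝕏 p k)) ([y-z]x≈yx-zx _ _ _))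
    by-𝕏q : ∀ k → (D p k * 𝕏 q ^ k) * 𝕏 q ≈ T (suc k)
    by-𝕏q k = trans (*-assoc _ _ _) (*-cong (D≈Horner p k) (*-comm _ _))

  W-sym : ∀ p q → W p q ≈ W q p
  W-sym p q = begin
    ∑[ k < n ] (D p (toℕ k) * 𝕏 q ^ toℕ k)
      ≈⟨ sum-cong-≋ {n} (λ k → *-congʳ (expand p (toℕ k))) ⟩
    ∑[ k < n ] (∑[ j < n ] (κ (Dmono (toℕ k) (toℕ j)) * 𝕏 p ^ toℕ j) * 𝕏 q ^ toℕ k)
      ≈⟨ sum-cong-≋ {n} (λ k → *-distribʳ-sum {n} (𝕏 q ^ toℕ k) (λ j → κ (Dmono (toℕ k) (toℕ j)) * 𝕏 p ^ toℕ j)) ⟩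
    ∑[ k < n ] ∑[ j < n ] ((κ (Dmono (toℕ k) (toℕ j)) * 𝕏 p ^ toℕ j) * 𝕏 q ^ toℕ k)
      ≈⟨ ∑-comm {n} {n} (λ k j → (κ (Dmono (toℕ k) (toℕ j)) * 𝕏 p ^ toℕ j) * 𝕏 q ^ toℕ k) ⟩
    ∑[ j < n ] ∑[ k < n ] ((κ (Dmono (toℕ k) (toℕ j)) * 𝕏 p ^ toℕ j) * 𝕏 q ^ toℕ k)
      ≈⟨ sum-cong-≋ {n} (λ j → sum-cong-≋ {n} (λ k → trans (xy∙z≈xz∙y _ _ _)
           (*-congʳ (*-congʳ (coefficientwise (constP-cong (Dmono-sym (toℕ k) (toℕ j)))))))) ⟩
    ∑[ j < n ] ∑[ k < n ] ((κ (Dmono (toℕ j) (toℕ k)) * 𝕏 q ^ toℕ k) * 𝕏 p ^ toℕ j)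
      ≈⟨ sum-cong-≋ {n} (λ j → *-distribʳ-sum {n} (𝕏 p ^ toℕ j) (λ k → κ (Dmono (toℕ j) (toℕ k)) * 𝕏 q ^ toℕ k)) ⟨
    ∑[ j < n ] (∑[ k < n ] (κ (Dmono (toℕ j) (toℕ k)) * 𝕏 q ^ toℕ k) * 𝕏 p ^ toℕ j)
      ≈⟨ sum-cong-≋ {n} (λ j → *-congʳ (expand q (toℕ j))) ⟨
    ∑[ j < n ] (D q (toℕ j) * 𝕏 p ^ toℕ j) ∎
    where
    expand : ∀ p k → D p k ≈ ∑[ j < n ] (κ (Dmono k (toℕ j)) * 𝕏 p ^ toℕ j)
    expand p k = univariate-expansion p (Dmono-vanishes k) n (Dmono-degree< k)

module CongModProperties {c ℓ} (R : CommutativeRing c ℓ) {r g : ℕ} (gens : Fin g → Poly.Series R r) where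
  open CommutativeRing R renaming (Carrier to K) hiding (zero)
  open Poly R using (Mon; Series; IsPoly; sumFin; CongMod; _≈ₚ_; _*ₚ_)
  open SeriesAlgebra R
  open CommutativeRingLemmas R using (-‿telescope)
  open import Algebra.Properties.Semiring.Sum semiring using (sum; sum-cong-≋; ∑-distrib-+; sum-replicate-zero)
  open CommutativeMonoidSum +-commutativeMonoid using (sum-single)
  open import Relation.Binary.Reasoning.Setoid setoid

  *ₚ-zeroʳ : ∀ (P : Series r) → (P *ₚ 0ₚ) ≈ₚ 0ₚ
  *ₚ-zeroʳ P m = sumBelow-zero m (λ _ _ → zeroʳ _)

  ≈ₚ⇒CongMod : ∀ {P Q} → P ≈ₚ Q → CongMod gens P Q
  ≈ₚ⇒CongMod {P} {Q} P≈Q = (λ _ → 0ₚ) , (λ _ → 0 , λ _ _ _ → refl) , λ m → begin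
    P m - Q m                            ≈⟨ +-congʳ (P≈Q m) ⟩
    Q m - Q m                            ≈⟨ -‿inverseʳ (Q m) ⟩
    0#                                   ≈⟨ sum-replicate-zero g ⟨
    sum {g} (λ _ → 0#)                   ≈⟨ sum-cong-≋ (λ i → *ₚ-zeroʳ (gens i) m) ⟨
    sum (λ i → (gens i *ₚ 0ₚ) m)         ≈⟨ sumFin≈sum (λ i → (gens i *ₚ 0ₚ) m) ⟨
    sumFin (λ i → (gens i *ₚ 0ₚ) m)      ∎

  CongMod-trans : ∀ {P Q S} → CongMod gens P Q → CongMod gens Q S → CongMod gens P S
  CongMod-trans {P} {Q} {S} (H , polyH , P-Q≈) (H′ , polyH′ , Q-S≈) =
    (λ i → H i +ₚ H′ i) , (λ i → isPoly-+ (polyH i) (polyH′ i)) , λ m → begin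
      P m - S m                                     ≈⟨ -‿telescope (P m) (Q m) (S m) ⟨
      (P m - Q m) + (Q m - S m)                     ≈⟨ +-cong (P-Q≈ m) (Q-S≈ m) ⟩
      sumFin (term H m) + sumFin (term H′ m)        ≈⟨ +-cong (sumFin≈sum (term H m)) (sumFin≈sum (term H′ m)) ⟩
      sum (term H m) + sum (term H′ m)              ≈⟨ ∑-distrib-+ (term H m) (term H′ m) ⟨
      sum (λ i → term H m i + term H′ m i)          ≈⟨ sum-cong-≋ (λ i → *ₚ-distribˡ (gens i) (H i) (H′ i) m) ⟨
      sum (term (λ i → H i +ₚ H′ i) m)              ≈⟨ sumFin≈sum (term (λ i → H i +ₚ H′ i) m) ⟨
      sumFin (term (λ i → H i +ₚ H′ i) m)           ∎
    where
    term : (Fin g → Series r) → Mon r → Fin g → K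
    term H m i = (gens i *ₚ H i) m

  CongMod-generator : ∀ j {P Q} → CongMod (λ (_ : Fin 1) → gens j) P Q → CongMod gens P Q
  CongMod-generator j {P} {Q} (H , polyH , P-Q≈) = H′ , polyH′ , λ m → begin
    P m - Q m                                ≈⟨ P-Q≈ m ⟩
    (gens j *ₚ H zero) m + 0#                ≈⟨ +-identityʳ _ ⟩
    (gens j *ₚ H zero) m                     ≈⟨ *ₚ-cong (λ _ → refl) (λ a → reflexive (≡.cong (λ h → h a) (H′-at-j))) m ⟨
    (gens j *ₚ H′ j) m                       ≈⟨ sum-single (λ i → (gens i *ₚ H′ i) m) j (off-j m) ⟨
    sum (λ i → (gens i *ₚ H′ i) m)           ≈⟨ sumFin≈sum (λ i → (gens i *ₚ H′ i) m) ⟨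
    sumFin (λ i → (gens i *ₚ H′ i) m)        ∎
    where
    H′ : Fin g → Series r
    H′ i = if does (i ≟ j) then H zero else 0ₚ
    H′-at-j : H′ j ≡ H zero
    H′-at-j = ≡.cong (if_then H zero else 0ₚ) (dec-true (j ≟ j) ≡.refl)
    polyH′ : ∀ i → IsPoly (H′ i)
    polyH′ i with does (i ≟ j)
    ... | true  = polyH zero
    ... | false = 0 , λ _ _ _ → refl
    off-j : ∀ m i → i ≢ j → (gens i *ₚ H′ i) m ≈ 0#
    off-j m i i≢j rewrite dec-false (i ≟ j) i≢j = *ₚ-zeroʳ (gens i) m

module WeilQuotient {c ℓ} (R : CommutativeRing c ℓ) (n : ℕ) (a : Fin n → CommutativeRing.Carrier R) (r : ℕ) where
  open PolynomialRing R r using (polynomialRing; 𝕏)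
  open WeilPolynomials R n a r
  open IdealQuotient polynomialRing f using (quotient; ≈⇒∼; gen∼0; sum∼sumᵠ; ^∼^ᵠ)
  open CommutativeRing quotient
  open CommutativeRingLemmas quotient using (ex≈ey⇒ep[x]≈ep[y])
  open import Algebra.Properties.Semiring.Sum semiring using (sum; sum-syntax; sum-cong-≋)
  open import Algebra.Properties.Semiring.Exp semiring using (_^_)
  open import Algebra.Properties.Group +-group using (x∙y⁻¹≈ε⇒x≈y)
  open import Relation.Binary.Reasoning.Setoid setoid
  private
    module PR where
      open CommutativeRing polynomialRing public using (_*_)
      open import Algebra.Properties.Semiring.Exp (CommutativeRing.semiring polynomialRing) public using (_^_)

  W-𝕏 : ∀ p q → W p q * 𝕏 p ≈ W p q * 𝕏 q
  W-𝕏 p q = x∙y⁻¹≈ε⇒x≈y _ _ (begin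
    W p q * 𝕏 p - W p q * 𝕏 q   ≈⟨ ≈⇒∼ (W-difference p q) ⟩
    f p - f q                   ≈⟨ +-cong (gen∼0 p) (-‿cong (gen∼0 q)) ⟩
    0# - 0#                     ≈⟨ -‿inverseʳ 0# ⟩
    0#                          ∎)

  W-symᵠ : ∀ p q → W p q ≈ W q p
  W-symᵠ p q = ≈⇒∼ (W-sym p q)

  W-as-polynomial : ∀ p q → W p q ≈ ∑[ k < n ] (D p (toℕ k) * 𝕏 q ^ toℕ k)
  W-as-polynomial p q =
    trans (sum∼sumᵠ {n} (λ k → D p (toℕ k) PR.* 𝕏 q PR.^ toℕ k)) (sum-cong-≋ {n} (λ k → *-congˡ (^∼^ᵠ (𝕏 q) (toℕ k))))

  W-slide : ∀ x y z → W y z * W x y ≈ W y z * W x z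
  W-slide x y z = begin
    W y z * W x y                                     ≈⟨ *-congˡ (W-as-polynomial x y) ⟩
    W y z * ∑[ k < n ] (D x (toℕ k) * 𝕏 y ^ toℕ k)    ≈⟨ ex≈ey⇒ep[x]≈ep[y] (W-𝕏 y z) {n} (λ k → D x (toℕ k)) ⟩
    W y z * ∑[ k < n ] (D x (toℕ k) * 𝕏 z ^ toℕ k)    ≈⟨ *-congˡ (W-as-polynomial x z) ⟨
    W y z * W x z                                     ∎

module WeilStar {c ℓ} (R : CommutativeRing c ℓ) (n : ℕ) (a : Fin n → CommutativeRing.Carrier R) where
  open CommutativeRing R using (trans; sym)
  open Poly R using (CongMod; prodFin)
  open Poly.WithF R n a using (fX; O2; Dmono; IsWeilOp)
  open SeriesAlgebra R using (Extensional; sumLT-cong; *ₚ-extensional; single-extensional; *ₚ-identityʳ)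

  O2-extensional : ∀ {r} (p q : Fin r) → Extensional (O2 p q)
  O2-extensional p q m≗ = sumLT-cong n (λ k → *ₚ-extensional (single-extensional p (Dmono k)) (single-extensional q _) m≗)

  weilOp-congMod-star : ∀ s {P} → IsWeilOp (suc s) P → CongMod fX P (prodFin (λ j → O2 (inject₁ j) (fromℕ s)))
  weilOp-congMod-star zero          (lift P≈1)   = CongModProperties.≈ₚ⇒CongMod R fX P≈1
  weilOp-congMod-star (suc zero)    (lift P≈O2)  =
    CongModProperties.≈ₚ⇒CongMod R fX (λ m → trans (P≈O2 m) (sym (*ₚ-identityʳ (O2-extensional zero (suc zero)) m)))
  weilOp-congMod-star (suc (suc s)) (_ , P∼star) = CongModProperties.CongMod-generator R fX (fromℕ (suc (suc s))) P∼star

module WeilTree {c ℓ} (R : CommutativeRing c ℓ) (n : ℕ) (a : Fin n → CommutativeRing.Carrier R) (s : ℕ) where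
  private module K = CommutativeRing R
  open Poly R using (CongMod; prodFin; _≈ₚ_)
  open Poly.WithF R n a using (fX; O2)
  open SeriesAlgebra R using (*ₚ-cong)
  open PolynomialRing R (suc s) using (polynomialRing; coeff-*ᴾ; ∼⇒CongMod)
  open WeilPolynomials R n a (suc s) using (W; W-coeff; f)
  open WeilQuotient R n a (suc s) using (W-symᵠ; W-slide)
  open IdealQuotient polynomialRing f using (_∼_; quotient; ∏∼∏ᵠ; ∼-sym; ∼-trans)
  open CongModProperties R (fX {suc s}) using (≈ₚ⇒CongMod; CongMod-trans)
  open SpanningTree (CommutativeRing.*-commutativeMonoid quotient) using (spanningTree≈star)
  open import Algebra.Properties.CommutativeMonoid.Sum (CommutativeRing.*-commutativeMonoid polynomialRing)
    using () renaming (sum to ∏)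

  coeff-∏W : ∀ {k} (α β : Fin k → Fin (suc s)) → proj₁ (∏ (λ i → W (α i) (β i))) ≈ₚ prodFin (λ i → O2 (α i) (β i))
  coeff-∏W {zero}  α β m = K.refl
  coeff-∏W {suc k} α β m = K.trans (coeff-*ᴾ _ _ m) (*ₚ-cong (W-coeff (α zero) (β zero)) (coeff-∏W (α ∘ suc) (β ∘ suc)) m)

  star-congMod-tree : (α β : Fin s → Fin (suc s)) → Connected α β →
    CongMod fX (prodFin (λ j → O2 (inject₁ j) (fromℕ s))) (prodFin (λ i → O2 (α i) (β i)))
  star-congMod-tree α β connected =
    CongMod-trans (≈ₚ⇒CongMod (λ m → K.sym (coeff-∏W (λ j → inject₁ j) (λ _ → fromℕ s) m)))
      (CongMod-trans (∼⇒CongMod f star∼tree) (≈ₚ⇒CongMod (coeff-∏W α β)))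
    where
    star∼tree : ∏ (λ j → W (inject₁ j) (fromℕ s)) ∼ ∏ (λ i → W (α i) (β i))
    star∼tree = ∼-trans (∏∼∏ᵠ (λ j → W (inject₁ j) (fromℕ s)))
      (∼-trans (∼-sym (spanningTree≈star W W-symᵠ W-slide α β connected)) (∼-sym (∏∼∏ᵠ (λ i → W (α i) (β i)))))

proposition2p11 : ∀ {c ℓ} (R : CommutativeRing c ℓ) → IsFiniteField R →
    (n : ℕ) → 1 ≤ n → (a : Fin n → CommutativeRing.Carrier R) →
    (s : ℕ) → (α β : Fin s → Fin (suc s)) → Connected α β →
    (P : Poly.Series R (suc s)) → Poly.WithF.IsWeilOp R n a (suc s) P →
    Poly.CongMod R (Poly.WithF.fX R n a)
      P (Poly.prodFin R (λ i → Poly.WithF.O2 R n a (α i) (β i)))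
proposition2p11 R _ n _ a s α β connected P weilOp =
  CongMod-trans (weilOp-congMod-star s weilOp) (star-congMod-tree α β connected)
  where
  open CongModProperties R (Poly.WithF.fX R n a) using (CongMod-trans)
  open WeilStar R n a using (weilOp-congMod-star)
  open WeilTree R n a s using (star-congMod-tree)
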